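{- For all positive integers $k$, $$\frac{G^C_k(q;a,c,d)}{(cq;q)_k} = G^P_k(q;a,c,c,d),$$ i.e. $G^C_k(q;a,c,d) = (cq;q)_k\, G^P_k(q;a,b,c,d)\big|_{b=c}$.
   Context: For $n\in\mathbb{N}\cup\{\infty\}$, $(x;q)_n=\prod_{i=0}^{n-1}(1-xq^i)$. A coloured integer is a positive integer $m$ together with a colour, written $m_x$; its value is $m$. Capparelli-type partitions: use colours $a,c,d$ with the total order $1_a<1_c<1_d<2_a<2_c<2_d<3_a<\cdots$. A partition in $\mathcal{C}$ is a finite sequence $\lambda_1\ge\lambda_2\ge\cdots\ge\lambda_s$ of such coloured integers (non-increasing in this order; the empty sequence is allowed) such that whenever $\lambda_i=m_x$ and $\lambda_{i+1}=m'_y$, we have $m-m'\ge C(x,y)$, where $C(a,a)=2,C(a,c)=2,C(a,d)=2$; $C(c,a)=1,C(c,c)=1,C(c,d)=2$; $C(d,a)=0,C(d,c)=1,C(d,d)=2$. $G^C_k(q;a,c,d)=\sum_\lambda q^{|\lambda|}a^{\#_a(\lambda)}c^{\#_c(\lambda)}d^{\#_d(\lambda)}$, summed over $\lambda\in\mathcal{C}$ whose parts all have value at most $k$, where $|\lambda|$ is the sum of the values of the parts and $\#_x(\lambda)$ is the number of parts of colour $x$. Primc-type partitions: use colours $a,b,c,d$ with the total order $1_a<1_b<1_c<1_d<2_a<2_b<2_c<2_d<\cdots$. A partition in $\mathcal{P}$ is a finite non-increasing (in this order) sequence of such coloured integers such that consecutive parts $m_x$ (larger) and $m'_y$ (next)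 satisfy $m-m'\ge P(x,y)$, where $P(a,a)=2,P(a,b)=1,P(a,c)=2,P(a,d)=2$; $P(b,a)=1,P(b,b)=0,P(b,c)=1,P(b,d)=1$; $P(c,a)=0,P(c,b)=1,P(c,c)=0,P(c,d)=2$; $P(d,a)=0,P(d,b)=1,P(d,c)=0,P(d,d)=2$. $G^P_k(q;a,b,c,d)=\sum_\lambda q^{|\lambda|}a^{\#_a}b^{\#_b}c^{\#_c}d^{\#_d}$ over $\lambda\in\mathcal{P}$ whose parts all have value at most $k$. -}

module Defs where

open import Data.Nat using (ℕ; zero; suc; _+_; _∸_; _≤ᵇ_; _<ᵇ_; _≡ᵇ_; _⊔_)
open import Data.Integer using (ℤ; +_; -_) renaming (_+_ to _+ℤ_; _*_ to _*ℤ_; _-_ to _-ℤ_)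
open import Data.Bool using (Bool; true; false; _∧_; _∨_; if_then_else_)
open import Data.List using (List; []; _∷_; map; concatMap; filter; length; upTo)
open import Data.Product using (_×_; _,_; proj₁; proj₂)
open import Relation.Nullary.Decidable using (yes; no)
open import Data.Bool using (T)
open import Data.Bool.Properties using (T?)

-- Coloured integers and partitions, generic in the set of colours.
--   colours : list of all colours
--   rank    : position of a colour in the total order of colours
--   gap x y : minimal difference m - m' when m_x is immediately
--             followed by m'_y in a partition

module Coloured (Colour : Set) (colours : List Colour)
                (rank : Colour → ℕ) (gap : Colour → Colour → ℕ) where

  -- a coloured integer m_x: value m (≥ 1) and colour x
  Part : Set
  Part = ℕ × Colour

  val : Part → ℕ
  val = proj₁

  _≥P_ : Part → Part → Bool
  (m , x) ≥P (m' , y) = (m' <ᵇ m) ∨ ((m ≡ᵇ m') ∧ (rank y ≤ᵇ rank x))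

  boundedAll : ℕ → List Part → Bool
  boundedAll k [] = true
  boundedAll k ((m , x) ∷ ps) = (1 ≤ᵇ m) ∧ (m ≤ᵇ k) ∧ boundedAll k ps

  consec : List Part → Bool
  consec [] = true
  consec (p ∷ []) = true
  consec ((m , x) ∷ (m' , y) ∷ ps) =
    ((m , x) ≥P (m' , y)) ∧ (gap x y + m' ≤ᵇ m) ∧ consec ((m' , y) ∷ ps)

  isPartition≤ : ℕ → List Part → Bool
  isPartition≤ k λs = boundedAll k λs ∧ consec λs

  weight : List Part → ℕ
  weight [] = 0
  weight ((m , _) ∷ ps) = m + weight ps

  countCol : (Colour → Bool) → List Part → ℕ
  countCol t [] = 0
  countCol t ((_ , x) ∷ ps) = (if t x then 1 else 0) + countCol t ps

  -- all sequences of coloured integers with values in 1..k and total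
  -- weight n (fuel f ≥ n suffices since every value is ≥ 1)
  seqsF : ℕ → ℕ → ℕ → List (List Part)
  seqsF k zero    zero    = [] ∷ []
  seqsF k zero    (suc _) = []
  seqsF k (suc f) zero    = [] ∷ []
  seqsF k (suc f) (suc n) =
    concatMap (λ v → concatMap (λ x → map ((suc v , x) ∷_) (seqsF k f (n ∸ v)))
                                colours)
              (filter (λ v → T? (suc v ≤ᵇ (k Data.Nat.⊓ suc n))) (upTo (suc n)))

  seqs : ℕ → ℕ → List (List Part)
  seqs k n = seqsF k n n

  partitions : ℕ → ℕ → List (List Part)
  partitions k n = filter (λ l → T? (isPartition≤ k l)) (seqs k n)

data CCol : Set where
  a c d : CCol

rankC : CCol → ℕ
rankC a = 0
rankC c = 1
rankC d = 2

gapC : CCol → CCol → ℕ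
gapC a a = 2
gapC a c = 2
gapC a d = 2
gapC c a = 1
gapC c c = 1
gapC c d = 2
gapC d a = 0
gapC d c = 1
gapC d d = 2

module Cap = Coloured CCol (a ∷ c ∷ d ∷ []) rankC gapC

data PCol : Set where
  a b c d : PCol

rankP : PCol → ℕ
rankP a = 0
rankP b = 1
rankP c = 2
rankP d = 3

gapP : PCol → PCol → ℕ
gapP a a = 2
gapP a b = 1
gapP a c = 2
gapP a d = 2
gapP b a = 1
gapP b b = 0
gapP b c = 1
gapP b d = 1
gapP c a = 0
gapP c b = 1
gapP c c = 0
gapP c d = 2
gapP d a = 0
gapP d b = 1
gapP d c = 0
gapP d d = 2

module Pri = Coloured PCol (a ∷ b ∷ c ∷ d ∷ []) rankP gapP

-- Formal power series in q, a, c, d with integer coefficients,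
-- represented by their coefficient function:
--   F n i j l = coefficient of q^n a^i c^j d^l.

Series : Set
Series = ℕ → ℕ → ℕ → ℕ → ℤ

sumTo : ℕ → (ℕ → ℤ) → ℤ
sumTo zero    f = f 0
sumTo (suc n) f = sumTo n f +ℤ f (suc n)

_⊛_ : Series → Series → Series
(F ⊛ G) n i j l =
  sumTo n λ n₁ → sumTo i λ i₁ → sumTo j λ j₁ → sumTo l λ l₁ →
    F n₁ i₁ j₁ l₁ *ℤ G (n ∸ n₁) (i ∸ i₁) (j ∸ j₁) (l ∸ l₁)

mono : ℕ → ℕ → ℕ → ℕ → Series
mono n i j l n' i' j' l' =
  if (n ≡ᵇ n') ∧ (i ≡ᵇ i') ∧ (j ≡ᵇ j') ∧ (l ≡ᵇ l') then + 1 else + 0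

_⊖_ : Series → Series → Series
(F ⊖ G) n i j l = F n i j l -ℤ G n i j l

oneS : Series
oneS = mono 0 0 0 0

poch-cq : ℕ → Series
poch-cq zero    = oneS
poch-cq (suc k) = poch-cq k ⊛ (oneS ⊖ mono (suc k) 0 1 0)

isC : CCol → Bool
isC c = true
isC _ = false

isA-C isD-C : CCol → Bool
isA-C a = true
isA-C _ = false
isD-C d = true
isD-C _ = false

GC : ℕ → Series
GC k n i j l = + length (filter (λ λs → T? (
     (Cap.countCol isA-C λs ≡ᵇ i) ∧ (Cap.countCol isC λs ≡ᵇ j)
       ∧ (Cap.countCol isD-C λs ≡ᵇ l))) (Cap.partitions k n))

isA-P isB-P isC-P isD-P : PCol → Bool
isA-P a = true
isA-P _ = false
isB-P b = true
isB-P _ = false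
isC-P c = true
isC-P _ = false
isD-P d = true
isD-P _ = false

GP : ℕ → ℕ → ℕ → ℕ → ℕ → ℕ → ℤ
GP k n i h j l = + length (filter (λ λs → T? (
     (Pri.countCol isA-P λs ≡ᵇ i) ∧ (Pri.countCol isB-P λs ≡ᵇ h)
       ∧ (Pri.countCol isC-P λs ≡ᵇ j) ∧ (Pri.countCol isD-P λs ≡ᵇ l)))
     (Pri.partitions k n))

-- G^P_k(q;a,c,c,d): the specialisation b = c, i.e. the coefficient of
-- q^n a^i c^j d^l is Σ_{h + j' = j} [q^n a^i b^h c^j' d^l] G^P_k.
GP-b=c : ℕ → Series
GP-b=c k n i j l = sumTo j λ h → GP k n i h (j ∸ h) l

-- Both sides are computed by peeling off the largest part. If G(φ) counts the
-- partitions with parts ≤ k whose largest part satisfies φ, then adding a part u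
-- to φ adds x_u q^|u| G(parts allowed after u) to G(φ). For Capparelli partitions
-- this expresses F_m = G(≤ m_d), M_m = G(≤ m_c) and L_m = G(allowed after (m+1)_a)
-- through F, M and L at m - 1. For Primc partitions with b = c the same relations
-- hold after multiplication by 1 - c q^(m+1), because the parts (m+1)_b and
-- (m+1)_c may repeat. Induction on m gives F^C_m = (cq;q)_m F^P_m, and F_k is the
-- whole generating function. Series are coefficient functions, on which the
-- factors of (cq;q)_k act as shift operators.

module Submission where

open import Data.Bool using (Bool; true; false; _∧_; _∨_; if_then_else_; T)
open import Data.Bool.Properties using (∧-zeroʳ; ∧-identityʳ; ∧-assoc; ∧-comm; T-∧; T-≡)
open import Data.Empty using (⊥-elim)
open import Data.Integer using (ℤ; +_) renaming (_+_ to _+ℤ_; _*_ to _*ℤ_; _-_ to _-ℤ_)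
import Data.Integer.Properties as ℤ
open import Data.Integer.Tactic.RingSolver using (solve-∀)
open import Data.List using (List; []; _∷_; _++_; map; concatMap; filter; length; upTo; null)
import Data.List.Properties as List
open import Data.Nat using (ℕ; zero; suc; _+_; _∸_; _≤_; _<_; z≤n; s≤s; _≡ᵇ_; _≤ᵇ_; _⊓_)
open import Data.Nat.ListAction using (sum)
open import Data.Nat.ListAction.Properties using (sum-++)
import Data.Nat.Properties as ℕ
open import Algebra.Properties.CommutativeSemigroup ℕ.+-commutativeSemigroup using ()
  renaming (interchange to +-interchange)
open import Data.Product using (_×_; _,_; proj₁; proj₂)
open import Data.Sum using (inj₁; inj₂)
open import Data.Unit using (tt)
open import Function using (Equivalence; id)
open import Level using (0ℓ)
open import Relation.Binary.Bundles using (Setoid)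
import Relation.Binary.Reasoning.Setoid as SetoidReasoning
open import Relation.Binary.PropositionalEquality
open import Relation.Nullary using (yes; no)
open import Relation.Nullary.Decidable using (T?)

open import Defs

infix 4 _≈_
_≈_ : Series → Series → Set
F ≈ G = ∀ n i j l → F n i j l ≡ G n i j l

≈-setoid : Setoid 0ℓ 0ℓ
≈-setoid = record
  { Carrier       = Series
  ; _≈_           = _≈_
  ; isEquivalence = record
    { refl  = λ _ _ _ _ → refl
    ; sym   = λ p n i j l → sym (p n i j l)
    ; trans = λ p q n i j l → trans (p n i j l) (q n i j l)
    }
  }

open Setoid ≈-setoid public using () renaming (refl to ≈-refl; sym to ≈-sym; trans to ≈-trans)
module ≈-Reasoning = SetoidReasoning ≈-setoid

infixl 6 _⊕_
_⊕_ : Series → Series → Series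
(F ⊕ G) n i j l = F n i j l +ℤ G n i j l

⊕-cong : ∀ {F F′ G G′} → F ≈ F′ → G ≈ G′ → F ⊕ G ≈ F′ ⊕ G′
⊕-cong p q n i j l = cong₂ _+ℤ_ (p n i j l) (q n i j l)

⊕-congˡ : ∀ {F F′} G → F ≈ F′ → F ⊕ G ≈ F′ ⊕ G
⊕-congˡ G p n i j l = cong (_+ℤ G n i j l) (p n i j l)

⊕-congʳ : ∀ F {G G′} → G ≈ G′ → F ⊕ G ≈ F ⊕ G′
⊕-congʳ F q n i j l = cong (F n i j l +ℤ_) (q n i j l)

⊖-cong : ∀ {F F′ G G′} → F ≈ F′ → G ≈ G′ → F ⊖ G ≈ F′ ⊖ G′
⊖-cong p q n i j l = cong₂ _-ℤ_ (p n i j l) (q n i j l)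

⊖-congʳ : ∀ F {G G′} → G ≈ G′ → F ⊖ G ≈ F ⊖ G′
⊖-congʳ F q n i j l = cong (F n i j l -ℤ_) (q n i j l)

-- Multiplication by a power of one variable

shift : ℕ → (ℕ → ℤ) → ℕ → ℤ
shift zero    f x       = f x
shift (suc u) f zero    = + 0
shift (suc u) f (suc x) = shift u f x

shift-cong : ∀ u {f g : ℕ → ℤ} → (∀ x → f x ≡ g x) → ∀ x → shift u f x ≡ shift u g x
shift-cong zero    e x       = e x
shift-cong (suc u) e zero    = refl
shift-cong (suc u) e (suc x) = shift-cong u e x

shift-+ : ∀ u f g x → shift u (λ y → f y +ℤ g y) x ≡ shift u f x +ℤ shift u g x
shift-+ zero    f g x       = refl
shift-+ (suc u) f g zero    = refl
shift-+ (suc u) f g (suc x) = shift-+ u f g x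

shift-− : ∀ u f g x → shift u (λ y → f y -ℤ g y) x ≡ shift u f x -ℤ shift u g x
shift-− zero    f g x       = refl
shift-− (suc u) f g zero    = refl
shift-− (suc u) f g (suc x) = shift-− u f g x

shift-0 : ∀ u x → shift u (λ _ → + 0) x ≡ + 0
shift-0 zero    x       = refl
shift-0 (suc u) zero    = refl
shift-0 (suc u) (suc x) = shift-0 u x

shift-shift : ∀ u e f x → shift u (shift e f) x ≡ shift (u + e) f x
shift-shift zero    e f x       = refl
shift-shift (suc u) e f zero    = refl
shift-shift (suc u) e f (suc x) = shift-shift u e f x

shift-comm : ∀ u e f x → shift u (shift e f) x ≡ shift e (shift u f) x
shift-comm u e f x = begin
  shift u (shift e f) x ≡⟨ shift-shift u e f x ⟩
  shift (u + e) f x     ≡⟨ cong (λ s → shift s f x) (ℕ.+-comm u e) ⟩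
  shift (e + u) f x     ≡⟨ shift-shift e u f x ⟨
  shift e (shift u f) x ∎
  where open ≡-Reasoning

shift-swap : ∀ u e (h : ℕ → ℕ → ℤ) x y →
  shift u (λ x′ → shift e (h x′) y) x ≡ shift e (λ y′ → shift u (λ x′ → h x′ y′) x) y
shift-swap zero    e       h x       y       = refl
shift-swap (suc u) e       h zero    y       = sym (shift-0 e y)
shift-swap (suc u) zero    h (suc x) y       = refl
shift-swap (suc u) (suc e) h (suc x) zero    = shift-0 u x
shift-swap (suc u) (suc e) h (suc x) (suc y) = shift-swap u e h x y

shift-≤ : ∀ u f x → u ≤ x → shift u f x ≡ f (x ∸ u)
shift-≤ zero    f x       _         = refl
shift-≤ (suc u) f (suc x) (s≤s u≤x) = shift-≤ u f x u≤x

shift-> : ∀ u f x → x < u → shift u f x ≡ + 0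
shift-> (suc u) f zero    _         = refl
shift-> (suc u) f (suc x) (s≤s x<u) = shift-> u f x x<u

infixr 7 q^_·_ a^_·_ c^_·_ d^_·_
q^_·_ a^_·_ c^_·_ d^_·_ : ℕ → Series → Series
(q^ u · F) n i j l = shift u (λ n′ → F n′ i j l) n
(a^ u · F) n i j l = shift u (λ i′ → F n i′ j l) i
(c^ u · F) n i j l = shift u (λ j′ → F n i j′ l) j
(d^ u · F) n i j l = shift u (λ l′ → F n i j l′) l

infixr 7 aq^_·_ cq^_·_ dq^_·_
aq^_·_ cq^_·_ dq^_·_ : ℕ → Series → Series
aq^ m · F = a^ 1 · q^ m · F
cq^ m · F = c^ 1 · q^ m · F
dq^ m · F = d^ 1 · q^ m · F

record IsLinear (X : Series → Series) : Set where
  field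
    lin-cong : ∀ {F G} → F ≈ G → X F ≈ X G
    lin-⊕    : ∀ F G → X (F ⊕ G) ≈ X F ⊕ X G
    lin-⊖    : ∀ F G → X (F ⊖ G) ≈ X F ⊖ X G
open IsLinear public

record Commute (X Y : Series → Series) : Set where
  constructor mkCommute
  field commute : ∀ F → X (Y F) ≈ Y (X F)
open Commute public

private variable X Y Z : Series → Series

∘-linear : ∀ {X Y} → IsLinear X → IsLinear Y → IsLinear (λ F → X (Y F))
∘-linear {Y = Y} lx ly = record
  { lin-cong = λ p → lin-cong lx (lin-cong ly p)
  ; lin-⊕    = λ F G → ≈-trans (lin-cong lx (lin-⊕ ly F G)) (lin-⊕ lx (Y F) (Y G))
  ; lin-⊖    = λ F G → ≈-trans (lin-cong lx (lin-⊖ ly F G)) (lin-⊖ lx (Y F) (Y G))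
  }

commute-sym : Commute X Y → Commute Y X
commute-sym xy = mkCommute λ F → ≈-sym (commute xy F)

commute-∘ˡ : ∀ {X Y Z} → IsLinear X → Commute X Z → Commute Y Z → Commute (λ F → X (Y F)) Z
commute-∘ˡ {Y = Y} lx xz yz = mkCommute λ F → ≈-trans (lin-cong lx (commute yz F)) (commute xz (Y F))

commute-∘ʳ : ∀ {X Y Z} → IsLinear Y → Commute X Y → Commute X Z → Commute X (λ F → Y (Z F))
commute-∘ʳ {Z = Z} ly xy xz = mkCommute λ F → ≈-trans (commute xy (Z F)) (lin-cong ly (commute xz F))

q^-linear : ∀ u → IsLinear (q^ u ·_)
q^-linear u = record
  { lin-cong = λ p n i j l → shift-cong u (λ n′ → p n′ i j l) n
  ; lin-⊕    = λ F G n i j l → shift-+ u _ _ n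
  ; lin-⊖    = λ F G n i j l → shift-− u _ _ n
  }

a^-linear : ∀ u → IsLinear (a^ u ·_)
a^-linear u = record
  { lin-cong = λ p n i j l → shift-cong u (λ i′ → p n i′ j l) i
  ; lin-⊕    = λ F G n i j l → shift-+ u _ _ i
  ; lin-⊖    = λ F G n i j l → shift-− u _ _ i
  }

c^-linear : ∀ u → IsLinear (c^ u ·_)
c^-linear u = record
  { lin-cong = λ p n i j l → shift-cong u (λ j′ → p n i j′ l) j
  ; lin-⊕    = λ F G n i j l → shift-+ u _ _ j
  ; lin-⊖    = λ F G n i j l → shift-− u _ _ j
  }

d^-linear : ∀ u → IsLinear (d^ u ·_)
d^-linear u = record
  { lin-cong = λ p n i j l → shift-cong u (λ l′ → p n i j l′) l
  ; lin-⊕    = λ F G n i j l → shift-+ u _ _ l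
  ; lin-⊖    = λ F G n i j l → shift-− u _ _ l
  }

aq^-linear : ∀ m → IsLinear (aq^ m ·_)
aq^-linear m = ∘-linear (a^-linear 1) (q^-linear m)

cq^-linear : ∀ m → IsLinear (cq^ m ·_)
cq^-linear m = ∘-linear (c^-linear 1) (q^-linear m)

dq^-linear : ∀ m → IsLinear (dq^ m ·_)
dq^-linear m = ∘-linear (d^-linear 1) (q^-linear m)

q^-commutes-q^ : ∀ u e → Commute (q^ u ·_) (q^ e ·_)
q^-commutes-q^ u e = mkCommute λ F n i j l → shift-comm u e _ n

c^-commutes-c^ : ∀ u e → Commute (c^ u ·_) (c^ e ·_)
c^-commutes-c^ u e = mkCommute λ F n i j l → shift-comm u e _ j

q^-commutes-a^ : ∀ u e → Commute (q^ u ·_) (a^ e ·_)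
q^-commutes-a^ u e = mkCommute λ F n i j l → shift-swap u e _ n i

q^-commutes-c^ : ∀ u e → Commute (q^ u ·_) (c^ e ·_)
q^-commutes-c^ u e = mkCommute λ F n i j l → shift-swap u e _ n j

q^-commutes-d^ : ∀ u e → Commute (q^ u ·_) (d^ e ·_)
q^-commutes-d^ u e = mkCommute λ F n i j l → shift-swap u e _ n l

a^-commutes-c^ : ∀ u e → Commute (a^ u ·_) (c^ e ·_)
a^-commutes-c^ u e = mkCommute λ F n i j l → shift-swap u e _ i j

d^-commutes-c^ : ∀ u e → Commute (d^ u ·_) (c^ e ·_)
d^-commutes-c^ u e = mkCommute λ F n i j l → shift-swap u e _ l j

module _ (s : ℕ) where

  q^-commutes-cq^ : ∀ e → Commute (q^ e ·_) (cq^ s ·_)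
  q^-commutes-cq^ e = commute-∘ʳ (c^-linear 1) (q^-commutes-c^ e 1) (q^-commutes-q^ e s)

  a^-commutes-cq^ : ∀ e → Commute (a^ e ·_) (cq^ s ·_)
  a^-commutes-cq^ e = commute-∘ʳ (c^-linear 1) (a^-commutes-c^ e 1) (commute-sym (q^-commutes-a^ s e))

  c^-commutes-cq^ : ∀ e → Commute (c^ e ·_) (cq^ s ·_)
  c^-commutes-cq^ e = commute-∘ʳ (c^-linear 1) (c^-commutes-c^ e 1) (commute-sym (q^-commutes-c^ s e))

  d^-commutes-cq^ : ∀ e → Commute (d^ e ·_) (cq^ s ·_)
  d^-commutes-cq^ e = commute-∘ʳ (c^-linear 1) (d^-commutes-c^ e 1) (commute-sym (q^-commutes-d^ s e))

  cq^-commutes-cq^ : ∀ m → Commute (cq^ m ·_) (cq^ s ·_)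
  cq^-commutes-cq^ m = commute-∘ˡ (c^-linear 1) (c^-commutes-cq^ 1) (q^-commutes-cq^ m)

infixr 7 1-cq^_·_ poch_·_
1-cq^_·_ : ℕ → Series → Series
1-cq^ s · F = F ⊖ (cq^ s · F)

poch_·_ : ℕ → Series → Series
poch zero  · F = F
poch suc m · F = 1-cq^ suc m · poch m · F

1-cq^-linear : ∀ s → IsLinear (1-cq^ s ·_)
1-cq^-linear s = record
  { lin-cong = λ p → ⊖-cong p (lin-cong (cq^-linear s) p)
  ; lin-⊕    = λ F G n i j l → trans (cong ((F n i j l +ℤ G n i j l) -ℤ_) (lin-⊕ (cq^-linear s) F G n i j l))
                                      (interchange (F n i j l) (G n i j l) _ _)
  ; lin-⊖    = λ F G n i j l → trans (cong ((F n i j l -ℤ G n i j l) -ℤ_) (lin-⊖ (cq^-linear s) F G n i j l))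
                                      (interchange′ (F n i j l) (G n i j l) _ _)
  }
  where
  interchange : ∀ x y x′ y′ → (x +ℤ y) -ℤ (x′ +ℤ y′) ≡ (x -ℤ x′) +ℤ (y -ℤ y′)
  interchange = solve-∀
  interchange′ : ∀ x y x′ y′ → (x -ℤ y) -ℤ (x′ -ℤ y′) ≡ (x -ℤ x′) -ℤ (y -ℤ y′)
  interchange′ = solve-∀

poch-linear : ∀ m → IsLinear (poch m ·_)
poch-linear zero    = record { lin-cong = λ p → p ; lin-⊕ = λ _ _ → ≈-refl ; lin-⊖ = λ _ _ → ≈-refl }
poch-linear (suc m) = ∘-linear (1-cq^-linear (suc m)) (poch-linear m)

module _ (lx : IsLinear X) where

  commute-1-cq^ : ∀ s → Commute X (cq^ s ·_) → Commute X (1-cq^ s ·_)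
  commute-1-cq^ s xc = mkCommute λ F → ≈-trans (lin-⊖ lx F (cq^ s · F)) (⊖-congʳ (X F) (commute xc F))

  commute-poch : (∀ s → Commute X (cq^ s ·_)) → ∀ m → Commute X (poch m ·_)
  commute-poch xc zero    = mkCommute λ F → ≈-refl
  commute-poch xc (suc m) = mkCommute λ F →
    ≈-trans (commute (commute-1-cq^ (suc m) (xc (suc m))) (poch m · F))
            (lin-cong (1-cq^-linear (suc m)) (commute (commute-poch xc m) F))

poch-suc : ∀ m F → poch suc m · F ≈ poch m · 1-cq^ suc m · F
poch-suc m = commute (commute-poch (1-cq^-linear (suc m))
  (λ s → commute-sym (commute-1-cq^ (cq^-linear s) (suc m) (cq^-commutes-cq^ (suc m) s))) m)

1-cq^-fix : ∀ s {Z F} → Z ≈ F ⊕ cq^ s · Z → 1-cq^ s · Z ≈ F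
1-cq^-fix s {Z} {F} p n i j l =
  trans (cong (_-ℤ (cq^ s · Z) n i j l) (p n i j l)) (cancel (F n i j l) ((cq^ s · Z) n i j l))
  where
  cancel : ∀ x y → (x +ℤ y) -ℤ y ≡ x
  cancel = solve-∀

1-cq^-cancel : ∀ s A → 1-cq^ s · A ⊕ cq^ s · A ≈ A
1-cq^-cancel s A n i j l = cancel (A n i j l) ((cq^ s · A) n i j l)
  where
  cancel : ∀ x y → (x -ℤ y) +ℤ y ≡ x
  cancel = solve-∀

1-cq^-⊕-cq^ : ∀ s A B → 1-cq^ s · (A ⊕ cq^ s · B) ≈ 1-cq^ s · A ⊕ cq^ s · 1-cq^ s · B
1-cq^-⊕-cq^ s A B = ≈-trans (lin-⊕ (1-cq^-linear s) A (cq^ s · B))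
  (⊕-congʳ (1-cq^ s · A) (≈-sym (commute (commute-1-cq^ (cq^-linear s) s (cq^-commutes-cq^ s s)) B)))

1-cq^-dq^ : ∀ s m B → 1-cq^ s · dq^ m · B ≈ dq^ m · 1-cq^ s · B
1-cq^-dq^ s m B = ≈-sym (commute (commute-1-cq^ (dq^-linear m) s
  (commute-∘ˡ (d^-linear 1) (d^-commutes-cq^ s 1) (q^-commutes-cq^ s m))) B)

poch-aq^ : ∀ t m A → poch t · aq^ m · A ≈ aq^ m · poch t · A
poch-aq^ t m A = ≈-sym (commute (commute-poch (aq^-linear m)
  (λ s → commute-∘ˡ (a^-linear 1) (a^-commutes-cq^ s 1) (q^-commutes-cq^ s m)) t) A)

poch-cq^ : ∀ t m A → poch t · cq^ m · A ≈ cq^ m · poch t · A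
poch-cq^ t m A = ≈-sym (commute (commute-poch (cq^-linear m) (λ s → cq^-commutes-cq^ s m) t) A)

poch-dq^ : ∀ t m A → poch t · dq^ m · A ≈ dq^ m · poch t · A
poch-dq^ t m A = ≈-sym (commute (commute-poch (dq^-linear m)
  (λ s → commute-∘ˡ (d^-linear 1) (d^-commutes-cq^ s 1) (q^-commutes-cq^ s m)) t) A)

sumTo-cong : ∀ n {f g : ℕ → ℤ} → (∀ t → t ≤ n → f t ≡ g t) → sumTo n f ≡ sumTo n g
sumTo-cong zero    e = e 0 z≤n
sumTo-cong (suc n) e = cong₂ _+ℤ_ (sumTo-cong n (λ t p → e t (ℕ.m≤n⇒m≤1+n p))) (e (suc n) ℕ.≤-refl)

sumTo-vanish : ∀ n {f : ℕ → ℤ} → (∀ t → f t ≡ + 0) → sumTo n f ≡ + 0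
sumTo-vanish zero    e = e 0
sumTo-vanish (suc n) e = cong₂ _+ℤ_ (sumTo-vanish n e) (e (suc n))

sumTo-suc : ∀ n (f : ℕ → ℤ) → sumTo (suc n) f ≡ f 0 +ℤ sumTo n (λ t → f (suc t))
sumTo-suc zero    f = refl
sumTo-suc (suc n) f = trans (cong (_+ℤ f (suc (suc n))) (sumTo-suc n f)) (ℤ.+-assoc (f 0) _ _)

sumTo-dropFirst : ∀ n (f : ℕ → ℤ) → f 0 ≡ + 0 → sumTo (suc n) f ≡ sumTo n (λ t → f (suc t))
sumTo-dropFirst n f e = trans (sumTo-suc n f) (trans (cong (_+ℤ rest) e) (ℤ.+-identityˡ rest))
  where rest = sumTo n (λ t → f (suc t))

sumTo-first : ∀ n {f : ℕ → ℤ} → (∀ t → f (suc t) ≡ + 0) → sumTo n f ≡ f 0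
sumTo-first zero    e = refl
sumTo-first (suc n) {f} e = begin
  sumTo (suc n) f                   ≡⟨ sumTo-suc n f ⟩
  f 0 +ℤ sumTo n (λ t → f (suc t)) ≡⟨ cong (f 0 +ℤ_) (sumTo-vanish n e) ⟩
  f 0 +ℤ + 0                        ≡⟨ ℤ.+-identityʳ (f 0) ⟩
  f 0                               ∎
  where open ≡-Reasoning

sumTo-− : ∀ n (f g : ℕ → ℤ) → sumTo n (λ t → f t -ℤ g t) ≡ sumTo n f -ℤ sumTo n g
sumTo-− zero    f g = refl
sumTo-− (suc n) f g =
  trans (cong (_+ℤ (f (suc n) -ℤ g (suc n))) (sumTo-− n f g)) (interchange (sumTo n f) (sumTo n g) (f (suc n)) (g (suc n)))
  where
  interchange : ∀ x y x′ y′ → (x -ℤ y) +ℤ (x′ -ℤ y′) ≡ (x +ℤ x′) -ℤ (y +ℤ y′)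
  interchange = solve-∀

sumTo-reverse : ∀ n (f : ℕ → ℤ) → sumTo n (λ t → f (n ∸ t)) ≡ sumTo n f
sumTo-reverse zero    f = refl
sumTo-reverse (suc n) f = begin
  sumTo (suc n) (λ t → f (suc n ∸ t))     ≡⟨ sumTo-suc n (λ t → f (suc n ∸ t)) ⟩
  f (suc n) +ℤ sumTo n (λ t → f (n ∸ t)) ≡⟨ cong (f (suc n) +ℤ_) (sumTo-reverse n f) ⟩
  f (suc n) +ℤ sumTo n f                  ≡⟨ ℤ.+-comm (f (suc n)) _ ⟩
  sumTo n f +ℤ f (suc n)                  ∎
  where open ≡-Reasoning

sumTo-reflect : ∀ n {f g : ℕ → ℤ} → (∀ t → t ≤ n → f t ≡ g (n ∸ t)) → sumTo n f ≡ sumTo n g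
sumTo-reflect n {g = g} e = trans (sumTo-cong n e) (sumTo-reverse n g)

sumTo-+ : ∀ n (f g : ℕ → ℤ) → sumTo n (λ t → f t +ℤ g t) ≡ sumTo n f +ℤ sumTo n g
sumTo-+ zero    f g = refl
sumTo-+ (suc n) f g =
  trans (cong (_+ℤ (f (suc n) +ℤ g (suc n))) (sumTo-+ n f g)) (interchange (sumTo n f) (sumTo n g) (f (suc n)) (g (suc n)))
  where
  interchange : ∀ x y x′ y′ → (x +ℤ y) +ℤ (x′ +ℤ y′) ≡ (x +ℤ x′) +ℤ (y +ℤ y′)
  interchange = solve-∀

sumTo-single : ∀ n {w} {f : ℕ → ℤ} → (∀ t → t ≤ n → t ≢ w → f t ≡ + 0) → w ≤ n → sumTo n f ≡ f w
sumTo-single zero    e z≤n = refl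
sumTo-single (suc n) {w} {f} e w≤1+n with suc n ℕ.≟ w
... | yes refl = trans (cong (_+ℤ f (suc n)) (trans (sumTo-cong n λ t t≤n → e t (ℕ.m≤n⇒m≤1+n t≤n) (ℕ.<⇒≢ (s≤s t≤n)))
                                                     (sumTo-vanish n λ _ → refl)))
                       (ℤ.+-identityˡ (f (suc n)))
... | no 1+n≢w = begin
  sumTo n f +ℤ f (suc n) ≡⟨ cong₂ _+ℤ_ (sumTo-single n (λ t t≤n → e t (ℕ.m≤n⇒m≤1+n t≤n)) w≤n) (e (suc n) ℕ.≤-refl 1+n≢w) ⟩
  f w +ℤ + 0             ≡⟨ ℤ.+-identityʳ (f w) ⟩
  f w                    ∎
  where
  open ≡-Reasoning
  w≤n = ℕ.≤-pred (ℕ.≤∧≢⇒< w≤1+n (λ w≡1+n → 1+n≢w (sym w≡1+n)))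

⊛-cong : ∀ {A A′ G G′} → A ≈ A′ → G ≈ G′ → A ⊛ G ≈ A′ ⊛ G′
⊛-cong p q n i j l =
  sumTo-cong n λ n₁ _ → sumTo-cong i λ i₁ _ → sumTo-cong j λ j₁ _ → sumTo-cong l λ l₁ _ →
    cong₂ _*ℤ_ (p n₁ i₁ j₁ l₁) (q (n ∸ n₁) (i ∸ i₁) (j ∸ j₁) (l ∸ l₁))

⊛-congˡ : ∀ {A A′} G → A ≈ A′ → A ⊛ G ≈ A′ ⊛ G
⊛-congˡ G p = ⊛-cong {G = G} p (λ _ _ _ _ → refl)

⊛-comm : ∀ A G → A ⊛ G ≈ G ⊛ A
⊛-comm A G n i j l =
  sumTo-reflect n λ n₁ p → sumTo-reflect i λ i₁ q → sumTo-reflect j λ j₁ r → sumTo-reflect l λ l₁ s →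
    trans (ℤ.*-comm (A n₁ i₁ j₁ l₁) _) (cong (G (n ∸ n₁) (i ∸ i₁) (j ∸ j₁) (l ∸ l₁) *ℤ_)
      (sym (cong-coefficient (ℕ.m∸[m∸n]≡n p) (ℕ.m∸[m∸n]≡n q) (ℕ.m∸[m∸n]≡n r) (ℕ.m∸[m∸n]≡n s))))
  where
  cong-coefficient : ∀ {n n′ i i′ j j′ l l′} → n ≡ n′ → i ≡ i′ → j ≡ j′ → l ≡ l′ → A n i j l ≡ A n′ i′ j′ l′
  cong-coefficient refl refl refl refl = refl

⊖-⊛ : ∀ A B G → (A ⊖ B) ⊛ G ≈ (A ⊛ G) ⊖ (B ⊛ G)
⊖-⊛ A B G n i j l =
  trans (sumTo-cong n λ n₁ _ → trans (sumTo-cong i λ i₁ _ → trans (sumTo-cong j λ j₁ _ →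
           trans (sumTo-cong l λ l₁ _ → distrib (A n₁ i₁ j₁ l₁) (B n₁ i₁ j₁ l₁) _)
         (sumTo-− l _ _)) (sumTo-− j _ _)) (sumTo-− i _ _)) (sumTo-− n _ _)
  where
  distrib : ∀ x y z → (x -ℤ y) *ℤ z ≡ x *ℤ z -ℤ y *ℤ z
  distrib = solve-∀

oneS-⊛ : ∀ G → oneS ⊛ G ≈ G
oneS-⊛ G n i j l =
  trans (sumTo-first n λ _ → sumTo-vanish i λ _ → sumTo-vanish j λ _ → sumTo-vanish l λ _ → refl)
  (trans (sumTo-first i λ _ → sumTo-vanish j λ _ → sumTo-vanish l λ _ → refl)
  (trans (sumTo-first j λ _ → sumTo-vanish l λ _ → refl)
  (trans (sumTo-first l λ _ → refl)
         (ℤ.*-identityˡ (G n i j l)))))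

-- Shifting the left factor only reindexes the outer sum; ⊛-comm moves every shift there.
q-⊛ : ∀ A G → (q^ 1 · A) ⊛ G ≈ q^ 1 · (A ⊛ G)
q-⊛ A G zero    i j l = sumTo-vanish i λ _ → sumTo-vanish j λ _ → sumTo-vanish l λ _ → refl
q-⊛ A G (suc n) i j l =
  sumTo-dropFirst n term (sumTo-vanish i λ _ → sumTo-vanish j λ _ → sumTo-vanish l λ _ → refl)
  where
  term : ℕ → ℤ
  term n₁ = sumTo i λ i₁ → sumTo j λ j₁ → sumTo l λ l₁ →
    (q^ 1 · A) n₁ i₁ j₁ l₁ *ℤ G (suc n ∸ n₁) (i ∸ i₁) (j ∸ j₁) (l ∸ l₁)

c-⊛ : ∀ A G → (c^ 1 · A) ⊛ G ≈ c^ 1 · (A ⊛ G)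
c-⊛ A G n i zero    l = sumTo-vanish n λ _ → sumTo-vanish i λ _ → sumTo-vanish l λ _ → refl
c-⊛ A G n i (suc j) l = sumTo-cong n λ n₁ _ → sumTo-cong i λ i₁ _ →
  sumTo-dropFirst j (term n₁ i₁) (sumTo-vanish l λ _ → refl)
  where
  term : ℕ → ℕ → ℕ → ℤ
  term n₁ i₁ j₁ = sumTo l λ l₁ → (c^ 1 · A) n₁ i₁ j₁ l₁ *ℤ G (n ∸ n₁) (i ∸ i₁) (suc j ∸ j₁) (l ∸ l₁)

q^-⊛ : ∀ m A G → (q^ m · A) ⊛ G ≈ q^ m · (A ⊛ G)
q^-⊛ zero    A G = ≈-refl
q^-⊛ (suc m) A G = begin
  (q^ suc m · A) ⊛ G      ≈⟨ ⊛-congˡ G q^-suc ⟩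
  (q^ 1 · q^ m · A) ⊛ G   ≈⟨ q-⊛ (q^ m · A) G ⟩
  q^ 1 · ((q^ m · A) ⊛ G) ≈⟨ lin-cong (q^-linear 1) (q^-⊛ m A G) ⟩
  q^ 1 · q^ m · (A ⊛ G)   ≈⟨ q^-suc ⟨
  q^ suc m · (A ⊛ G)      ∎
  where
  open ≈-Reasoning
  q^-suc : ∀ {F} → q^ suc m · F ≈ q^ 1 · q^ m · F
  q^-suc n i j l = sym (shift-shift 1 m _ n)

cq^-⊛ : ∀ m A G → (cq^ m · A) ⊛ G ≈ cq^ m · (A ⊛ G)
cq^-⊛ m A G = ≈-trans (c-⊛ (q^ m · A) G) (lin-cong (c^-linear 1) (q^-⊛ m A G))

mono-cq : ∀ m → mono m 0 1 0 ≈ cq^ m · oneS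
mono-cq zero    zero    zero    zero    l = refl
mono-cq zero    zero    zero    (suc j) l = refl
mono-cq zero    zero    (suc i) zero    l = refl
mono-cq zero    zero    (suc i) (suc j) l = refl
mono-cq zero    (suc n) i       zero    l = refl
mono-cq zero    (suc n) i       (suc j) l = refl
mono-cq (suc m) zero    i       zero    l = refl
mono-cq (suc m) zero    i       (suc j) l = refl
mono-cq (suc m) (suc n) i       j       l = mono-cq m n i j l

⊛-1-cq^ : ∀ m A → A ⊛ (oneS ⊖ mono m 0 1 0) ≈ 1-cq^ m · A
⊛-1-cq^ m A = begin
  A ⊛ (oneS ⊖ mono m 0 1 0)                 ≈⟨ ⊛-comm A (oneS ⊖ mono m 0 1 0) ⟩
  (oneS ⊖ mono m 0 1 0) ⊛ A                 ≈⟨ ⊖-⊛ oneS _ A ⟩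
  (oneS ⊛ A) ⊖ (mono m 0 1 0 ⊛ A)           ≈⟨ ⊖-cong (oneS-⊛ A) (⊛-congˡ A (mono-cq m)) ⟩
  A ⊖ ((cq^ m · oneS) ⊛ A)                  ≈⟨ ⊖-congʳ A (cq^-⊛ m oneS A) ⟩
  A ⊖ (cq^ m · (oneS ⊛ A))                  ≈⟨ ⊖-congʳ A (lin-cong (cq^-linear m) (oneS-⊛ A)) ⟩
  1-cq^ m · A                               ∎
  where open ≈-Reasoning

1-cq^-⊛ : ∀ m A G → (1-cq^ m · A) ⊛ G ≈ 1-cq^ m · (A ⊛ G)
1-cq^-⊛ m A G = ≈-trans (⊖-⊛ A (cq^ m · A) G) (⊖-congʳ (A ⊛ G) (cq^-⊛ m A G))

poch-cq-⊛ : ∀ k G → poch-cq k ⊛ G ≈ poch k · G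
poch-cq-⊛ zero    G = oneS-⊛ G
poch-cq-⊛ (suc k) G = begin
  (poch-cq k ⊛ (oneS ⊖ mono (suc k) 0 1 0)) ⊛ G ≈⟨ ⊛-congˡ G (⊛-1-cq^ (suc k) (poch-cq k)) ⟩
  (1-cq^ suc k · poch-cq k) ⊛ G                 ≈⟨ 1-cq^-⊛ (suc k) (poch-cq k) G ⟩
  1-cq^ suc k · (poch-cq k ⊛ G)                 ≈⟨ lin-cong (1-cq^-linear (suc k)) (poch-cq-⊛ k G) ⟩
  poch suc k · G                                ∎
  where open ≈-Reasoning

record CapparelliRecurrence (k : ℕ) (F M L : ℕ → Series) : Set where
  field
    F-suc : ∀ m → suc m ≤ k → F (suc m) ≈ M (suc m) ⊕ dq^ suc m · (M m ⊕ aq^ suc m · L m)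
    M-suc : ∀ m → suc m ≤ k → M (suc m) ≈ (F m ⊕ aq^ suc m · L m) ⊕ cq^ suc m · M m
    L-suc : ∀ m → L (suc m) ≈ F m

record PrimcRecurrence (k : ℕ) (F M L : ℕ → Series) : Set where
  field
    F-suc : ∀ m → suc m ≤ k →
      1-cq^ suc m · F (suc m) ≈ 1-cq^ suc m · M (suc m) ⊕ dq^ suc m · (M m ⊕ aq^ suc m · L m)
    M-suc : ∀ m → suc m ≤ k → 1-cq^ suc m · M (suc m) ≈ (F m ⊕ aq^ suc m · L m) ⊕ cq^ suc m · M m
    L-suc : ∀ m → suc m ≤ k → 1-cq^ suc m · L (suc m) ≈ F m

poch-⊕-aq^-cq^ : ∀ t s A B C →
  poch t · ((A ⊕ aq^ s · B) ⊕ cq^ s · C) ≈ (poch t · A ⊕ aq^ s · poch t · B) ⊕ cq^ s · poch t · C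
poch-⊕-aq^-cq^ t s A B C = begin
  poch t · ((A ⊕ aq^ s · B) ⊕ cq^ s · C)
    ≈⟨ lin-⊕ (poch-linear t) (A ⊕ aq^ s · B) (cq^ s · C) ⟩
  poch t · (A ⊕ aq^ s · B) ⊕ poch t · cq^ s · C
    ≈⟨ ⊕-cong (lin-⊕ (poch-linear t) A (aq^ s · B)) (poch-cq^ t s C) ⟩
  (poch t · A ⊕ poch t · aq^ s · B) ⊕ cq^ s · poch t · C
    ≈⟨ ⊕-congˡ (cq^ s · poch t · C) (⊕-congʳ (poch t · A) (poch-aq^ t s B)) ⟩
  (poch t · A ⊕ aq^ s · poch t · B) ⊕ cq^ s · poch t · C ∎
  where open ≈-Reasoning

poch-⊕-dq^-aq^ : ∀ t s A B C →
  poch t · (A ⊕ dq^ s · (B ⊕ aq^ s · C)) ≈ poch t · A ⊕ dq^ s · (poch t · B ⊕ aq^ s · poch t · C)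
poch-⊕-dq^-aq^ t s A B C = begin
  poch t · (A ⊕ dq^ s · (B ⊕ aq^ s · C))
    ≈⟨ lin-⊕ (poch-linear t) A (dq^ s · (B ⊕ aq^ s · C)) ⟩
  poch t · A ⊕ poch t · dq^ s · (B ⊕ aq^ s · C)
    ≈⟨ ⊕-congʳ (poch t · A) (poch-dq^ t s (B ⊕ aq^ s · C)) ⟩
  poch t · A ⊕ dq^ s · poch t · (B ⊕ aq^ s · C)
    ≈⟨ ⊕-congʳ (poch t · A) (lin-cong (dq^-linear s)
         (≈-trans (lin-⊕ (poch-linear t) B (aq^ s · C)) (⊕-congʳ (poch t · B) (poch-aq^ t s C)))) ⟩
  poch t · A ⊕ dq^ s · (poch t · B ⊕ aq^ s · poch t · C) ∎
  where open ≈-Reasoning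

module _ {k} {F M L F′ M′ L′ : ℕ → Series}
         (C : CapparelliRecurrence k F M L) (P : PrimcRecurrence k F′ M′ L′) where

  private
    module C = CapparelliRecurrence C
    module P = PrimcRecurrence P

  recurrence-transfer : F 0 ≈ F′ 0 → M 0 ≈ M′ 0 → L 0 ≈ L′ 0 →
    ∀ m → m ≤ k → F m ≈ poch m · F′ m × M m ≈ poch m · M′ m × L m ≈ poch m · L′ m
  recurrence-transfer F₀ M₀ L₀ zero    _   = F₀ , M₀ , L₀
  recurrence-transfer F₀ M₀ L₀ (suc m) m<k = F-step , M-step , L-step
    where
    open ≈-Reasoning
    IH = recurrence-transfer F₀ M₀ L₀ m (ℕ.<⇒≤ m<k)
    iF = proj₁ IH
    iM = proj₁ (proj₂ IH)
    iL = proj₂ (proj₂ IH)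
    m′ = suc m

    M-step : M m′ ≈ poch m′ · M′ m′
    M-step = begin
      M m′
        ≈⟨ C.M-suc m m<k ⟩
      (F m ⊕ aq^ m′ · L m) ⊕ cq^ m′ · M m
        ≈⟨ ⊕-cong (⊕-cong iF (lin-cong (aq^-linear m′) iL)) (lin-cong (cq^-linear m′) iM) ⟩
      (poch m · F′ m ⊕ aq^ m′ · poch m · L′ m) ⊕ cq^ m′ · poch m · M′ m
        ≈⟨ poch-⊕-aq^-cq^ m m′ (F′ m) (L′ m) (M′ m) ⟨
      poch m · ((F′ m ⊕ aq^ m′ · L′ m) ⊕ cq^ m′ · M′ m)
        ≈⟨ lin-cong (poch-linear m) (P.M-suc m m<k) ⟨
      poch m · 1-cq^ m′ · M′ m′
        ≈⟨ poch-suc m (M′ m′) ⟨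
      poch m′ · M′ m′ ∎

    L-step : L m′ ≈ poch m′ · L′ m′
    L-step = begin
      L m′                      ≈⟨ C.L-suc m ⟩
      F m                       ≈⟨ iF ⟩
      poch m · F′ m             ≈⟨ lin-cong (poch-linear m) (P.L-suc m m<k) ⟨
      poch m · 1-cq^ m′ · L′ m′ ≈⟨ poch-suc m (L′ m′) ⟨
      poch m′ · L′ m′           ∎

    F-step : F m′ ≈ poch m′ · F′ m′
    F-step = begin
      F m′
        ≈⟨ C.F-suc m m<k ⟩
      M m′ ⊕ dq^ m′ · (M m ⊕ aq^ m′ · L m)
        ≈⟨ ⊕-cong (≈-trans M-step (poch-suc m (M′ m′)))
                  (lin-cong (dq^-linear m′) (⊕-cong iM (lin-cong (aq^-linear m′) iL))) ⟩
      poch m · (1-cq^ m′ · M′ m′) ⊕ dq^ m′ · (poch m · M′ m ⊕ aq^ m′ · poch m · L′ m)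
        ≈⟨ poch-⊕-dq^-aq^ m m′ (1-cq^ m′ · M′ m′) (M′ m) (L′ m) ⟨
      poch m · (1-cq^ m′ · M′ m′ ⊕ dq^ m′ · (M′ m ⊕ aq^ m′ · L′ m))
        ≈⟨ lin-cong (poch-linear m) (P.F-suc m m<k) ⟨
      poch m · 1-cq^ m′ · F′ m′
        ≈⟨ poch-suc m (F′ m′) ⟨
      poch m′ · F′ m′ ∎

𝟙 : Bool → ℕ
𝟙 x = if x then 1 else 0

count : {A : Set} → (A → Bool) → List A → ℕ
count p []       = 0
count p (x ∷ xs) = 𝟙 (p x) + count p xs

module _ {A : Set} where

  count-cong : ∀ {p q : A → Bool} xs → (∀ x → p x ≡ q x) → count p xs ≡ count q xs
  count-cong []       e = refl
  count-cong (x ∷ xs) e = cong₂ _+_ (cong 𝟙 (e x)) (count-cong xs e)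

  count-split : ∀ {p q r : A → Bool} xs → (∀ x → 𝟙 (p x) ≡ 𝟙 (q x) + 𝟙 (r x)) →
                count p xs ≡ count q xs + count r xs
  count-split []                 e = refl
  count-split {p} {q} {r} (x ∷ xs) e = begin
    𝟙 (p x) + count p xs                            ≡⟨ cong₂ _+_ (e x) (count-split xs e) ⟩
    (𝟙 (q x) + 𝟙 (r x)) + (count q xs + count r xs) ≡⟨ +-interchange (𝟙 (q x)) (𝟙 (r x)) (count q xs) (count r xs) ⟩
    (𝟙 (q x) + count q xs) + (𝟙 (r x) + count r xs) ∎
    where open ≡-Reasoning

  count-none : ∀ {p : A → Bool} xs → (∀ x → p x ≡ false) → count p xs ≡ 0
  count-none []       e = refl
  count-none (x ∷ xs) e rewrite e x = count-none xs e

  count-guard : ∀ g (p : A → Bool) xs → count (λ x → g ∧ p x) xs ≡ (if g then count p xs else 0)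
  count-guard true  p xs = refl
  count-guard false p xs = count-none xs (λ _ → refl)

  count-++ : ∀ (p : A → Bool) xs ys → count p (xs ++ ys) ≡ count p xs + count p ys
  count-++ p []       ys = refl
  count-++ p (x ∷ xs) ys = trans (cong (_+_ (𝟙 (p x))) (count-++ p xs ys)) (sym (ℕ.+-assoc (𝟙 (p x)) _ _))

  count-map : ∀ {B : Set} (p : A → Bool) (f : B → A) xs → count p (map f xs) ≡ count (λ x → p (f x)) xs
  count-map p f []       = refl
  count-map p f (x ∷ xs) = cong (_+_ (𝟙 (p (f x)))) (count-map p f xs)

  count-concatMap : ∀ {B : Set} (p : A → Bool) (f : B → List A) xs →
                    count p (concatMap f xs) ≡ sum (map (λ x → count p (f x)) xs)
  count-concatMap p f []       = refl
  count-concatMap p f (x ∷ xs) =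
    trans (count-++ p (f x) (concatMap f xs)) (cong (_+_ (count p (f x))) (count-concatMap p f xs))

  length-filter-filter : ∀ (p q : A → Bool) xs →
    length (filter (λ x → T? (q x)) (filter (λ x → T? (p x)) xs)) ≡ count (λ x → p x ∧ q x) xs
  length-filter-filter p q [] = refl
  length-filter-filter p q (x ∷ xs) with p x
  ... | false = length-filter-filter p q xs
  ... | true with q x
  ...   | false = length-filter-filter p q xs
  ...   | true  = cong suc (length-filter-filter p q xs)

module _ {A : Set} where

  sum-map-cong : ∀ {f g : A → ℕ} xs → (∀ x → f x ≡ g x) → sum (map f xs) ≡ sum (map g xs)
  sum-map-cong []       e = refl
  sum-map-cong (x ∷ xs) e = cong₂ _+_ (e x) (sum-map-cong xs e)

  sum-map-zero : ∀ {f : A → ℕ} xs → (∀ x → f x ≡ 0) → sum (map f xs) ≡ 0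
  sum-map-zero []       e = refl
  sum-map-zero (x ∷ xs) e = cong₂ _+_ (e x) (sum-map-zero xs e)

  sum-filter : ∀ (f : A → ℕ) (p : A → Bool) xs →
    sum (map f (filter (λ x → T? (p x)) xs)) ≡ sum (map (λ x → if p x then f x else 0) xs)
  sum-filter f p [] = refl
  sum-filter f p (x ∷ xs) with p x
  ... | true  = cong (_+_ (f x)) (sum-filter f p xs)
  ... | false = sum-filter f p xs

module _ {g : ℕ → ℕ} {w : ℕ} (off-w : ∀ v → v ≢ w → g v ≡ 0) where

  private
    sum-upTo-suc : ∀ N → sum (map g (upTo (suc N))) ≡ sum (map g (upTo N)) + g N
    sum-upTo-suc N = begin
      sum (map g (upTo (suc N)))          ≡⟨ cong (λ xs → sum (map g xs)) (List.upTo-∷ʳ N) ⟨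
      sum (map g (upTo N ++ N ∷ []))      ≡⟨ cong sum (List.map-++ g (upTo N) (N ∷ [])) ⟩
      sum (map g (upTo N) ++ g N ∷ [])    ≡⟨ sum-++ (map g (upTo N)) (g N ∷ []) ⟩
      sum (map g (upTo N)) + (g N + 0)    ≡⟨ cong (_+_ (sum (map g (upTo N)))) (ℕ.+-identityʳ (g N)) ⟩
      sum (map g (upTo N)) + g N          ∎
      where open ≡-Reasoning

  sum-upTo-outside : ∀ N → N ≤ w → sum (map g (upTo N)) ≡ 0
  sum-upTo-outside zero    _ = refl
  sum-upTo-outside (suc N) N<w = begin
    sum (map g (upTo (suc N)))   ≡⟨ sum-upTo-suc N ⟩
    sum (map g (upTo N)) + g N   ≡⟨ cong₂ _+_ (sum-upTo-outside N (ℕ.<⇒≤ N<w)) (off-w N (ℕ.<⇒≢ N<w)) ⟩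
    0                            ∎
    where open ≡-Reasoning

  sum-upTo-inside : ∀ N → w < N → sum (map g (upTo N)) ≡ g w
  sum-upTo-inside (suc N) w<N with N ℕ.≟ w
  ... | yes refl = trans (sum-upTo-suc N) (cong (_+ g N) (sum-upTo-outside N ℕ.≤-refl))
  ... | no  N≢w  = begin
    sum (map g (upTo (suc N)))   ≡⟨ sum-upTo-suc N ⟩
    sum (map g (upTo N)) + g N   ≡⟨ cong₂ _+_ (sum-upTo-inside N w<N′) (off-w N N≢w) ⟩
    g w + 0                      ≡⟨ ℕ.+-identityʳ (g w) ⟩
    g w                          ∎
    where
    open ≡-Reasoning
    w<N′ = ℕ.≤∧≢⇒< (ℕ.≤-pred w<N) (λ w≡N → N≢w (sym w≡N))

𝟙-∧-split : ∀ g {s s₁ s₂} → 𝟙 s ≡ 𝟙 s₁ + 𝟙 s₂ → 𝟙 (g ∧ s) ≡ 𝟙 (g ∧ s₁) + 𝟙 (g ∧ s₂)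
𝟙-∧-split true  e = e
𝟙-∧-split false e = refl

𝟙-∧-splitʳ : ∀ s s₁ s₂ P → (T P → 𝟙 s ≡ 𝟙 s₁ + 𝟙 s₂) → 𝟙 (s ∧ P) ≡ 𝟙 (s₁ ∧ P) + 𝟙 (s₂ ∧ P)
𝟙-∧-splitʳ s s₁ s₂ false _ rewrite ∧-zeroʳ s | ∧-zeroʳ s₁ | ∧-zeroʳ s₂ = refl
𝟙-∧-splitʳ s s₁ s₂ true  e rewrite ∧-identityʳ s | ∧-identityʳ s₁ | ∧-identityʳ s₂ = e tt

∧-congʳ : ∀ s s′ P → (T P → s ≡ s′) → s ∧ P ≡ s′ ∧ P
∧-congʳ s s′ false _ rewrite ∧-zeroʳ s | ∧-zeroʳ s′ = refl
∧-congʳ s s′ true  e = cong (_∧ true) (e tt)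

𝟙-shift : ∀ (ctx : Bool → Bool) → ctx false ≡ false → ∀ e A i →
          + 𝟙 (ctx ((𝟙 e + A) ≡ᵇ i)) ≡ shift (𝟙 e) (λ i′ → + 𝟙 (ctx (A ≡ᵇ i′))) i
𝟙-shift ctx _     false A i       = refl
𝟙-shift ctx ctx-false true A zero rewrite ctx-false = refl
𝟙-shift ctx _     true  A (suc i) = refl

∧-rotate : ∀ p x y z → p ∧ (x ∧ (y ∧ z)) ≡ x ∧ (y ∧ (z ∧ p))
∧-rotate true  x y z = cong (λ w → x ∧ (y ∧ w)) (sym (∧-identityʳ z))
∧-rotate false x y z = sym (trans (cong (λ w → x ∧ (y ∧ w)) (∧-zeroʳ z))
                                  (trans (cong (x ∧_) (∧-zeroʳ y)) (∧-zeroʳ x)))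

∧-left-comm : ∀ x y z → x ∧ (y ∧ z) ≡ y ∧ (x ∧ z)
∧-left-comm true  y     z = refl
∧-left-comm false true  z = refl
∧-left-comm false false z = refl

≡ᵇ-refl : ∀ n → (n ≡ᵇ n) ≡ true
≡ᵇ-refl n = Equivalence.to T-≡ (ℕ.≡⇒≡ᵇ n n refl)

≢⇒≡ᵇ-false : ∀ {v w} → v ≢ w → (v ≡ᵇ w) ≡ false
≢⇒≡ᵇ-false {v} {w} v≢w with v ≡ᵇ w in eq
... | false = refl
... | true  = ⊥-elim (v≢w (ℕ.≡ᵇ⇒≡ v w (subst T (sym eq) tt)))

-- Generating series of coloured partitions, by their largest part

module PartitionSeries
  (Colour : Set) (colours : List Colour) (rank : Colour → ℕ) (gap : Colour → Colour → ℕ)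
  (isA isC isD : Colour → Bool)
  -- every colour occurs exactly once in colours, and distinct colours have distinct ranks
  (sum-colours : ∀ (g : Colour → ℕ) x →
                 sum (map (λ y → if rank y ≡ᵇ rank x then g y else 0) colours) ≡ g x)
  where

  open Coloured Colour colours rank gap public

  infix 4 _≐_
  _≐_ : Part → Part → Bool
  (v , y) ≐ (m , x) = (rank y ≡ᵇ rank x) ∧ (v ≡ᵇ m)

  compat : Part → Part → Bool
  compat (m , x) (m′ , y) = ((m , x) ≥P (m′ , y)) ∧ (gap x y + m′ ≤ᵇ m)

  infixr 7 colour^_·_ ⟦_⟧·_
  colour^_·_ : Colour → Series → Series
  colour^ x · F = a^ 𝟙 (isA x) · c^ 𝟙 (isC x) · d^ 𝟙 (isD x) · F

  ⟦_⟧·_ : Part → Series → Series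
  ⟦ m , x ⟧· F = colour^ x · q^ m · F

  colour^-linear : ∀ x → IsLinear (colour^ x ·_)
  colour^-linear x = ∘-linear (a^-linear (𝟙 (isA x))) (∘-linear (c^-linear (𝟙 (isC x))) (d^-linear (𝟙 (isD x))))

  colour^-vanish : ∀ x F n i j l → (∀ i′ j′ l′ → F n i′ j′ l′ ≡ + 0) → (colour^ x · F) n i j l ≡ + 0
  colour^-vanish x F n i j l e =
    trans (shift-cong (𝟙 (isA x)) (λ i′ →
      trans (shift-cong (𝟙 (isC x)) (λ j′ →
        trans (shift-cong (𝟙 (isD x)) (e i′ j′) l) (shift-0 (𝟙 (isD x)) l)) j) (shift-0 (𝟙 (isC x)) j)) i)
      (shift-0 (𝟙 (isA x)) i)

  selects : ℕ → ℕ → ℕ → (List Part → Bool) → List Part → Bool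
  selects i j l S λs =
    (countCol isA λs ≡ᵇ i) ∧ ((countCol isC λs ≡ᵇ j) ∧ ((countCol isD λs ≡ᵇ l) ∧ S λs))

  headFits headFits⁺ : (Part → Bool) → List Part → Bool
  headFits  φ []      = true
  headFits  φ (q ∷ _) = φ q
  headFits⁺ φ []      = false
  headFits⁺ φ (q ∷ _) = φ q

  selects-false : ∀ i j l S λs → S λs ≡ false → selects i j l S λs ≡ false
  selects-false i j l S λs e rewrite e
    | ∧-zeroʳ (countCol isD λs ≡ᵇ l) | ∧-zeroʳ (countCol isC λs ≡ᵇ j) = ∧-zeroʳ (countCol isA λs ≡ᵇ i)

  selects-guard : ∀ i j l g S λs → selects i j l (λ μs → g ∧ S μs) λs ≡ g ∧ selects i j l S λs
  selects-guard i j l true  S λs = refl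
  selects-guard i j l false S λs = selects-false i j l (λ _ → false) λs refl

  consec-cons : ∀ u r → consec (u ∷ r) ≡ headFits (compat u) r ∧ consec r
  consec-cons u       []              = refl
  consec-cons (m , x) ((m′ , y) ∷ r) = sym (∧-assoc ((m , x) ≥P (m′ , y)) _ _)

  count-cons : ∀ m x (S : List Part → Bool) L →
    (λ _ i j l → + count (λ r → selects i j l S ((m , x) ∷ r)) L) ≈
    colour^ x · (λ _ i j l → + count (selects i j l (λ r → S ((m , x) ∷ r))) L)
  count-cons m x S []      n i j l = sym (colour^-vanish x (λ _ _ _ _ → + 0) n i j l (λ _ _ _ → refl))
  count-cons m x S (r ∷ L) n i j l = begin
    + (𝟙 (P r) + count P L)                          ≡⟨ ℤ.pos-+ (𝟙 (P r)) (count P L) ⟩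
    + 𝟙 (P r) +ℤ + count P L                          ≡⟨ cong₂ _+ℤ_ head (count-cons m x S L n i j l) ⟩
    (colour^ x · H₁) n i j l +ℤ (colour^ x · H) n i j l ≡⟨ lin-⊕ (colour^-linear x) H₁ H n i j l ⟨
    (colour^ x · (H₁ ⊕ H)) n i j l                    ≡⟨ lin-cong (colour^-linear x) H₁⊕H≈ n i j l ⟩
    (colour^ x · (λ _ i j l → + count (selects i j l S′) (r ∷ L))) n i j l ∎
    where
    open ≡-Reasoning
    S′ : List Part → Bool
    S′ μs = S ((m , x) ∷ μs)
    P : List Part → Bool
    P μs = selects i j l S ((m , x) ∷ μs)
    H₁ H : Series
    H₁ _ i j l = + 𝟙 (selects i j l S′ r)
    H  _ i j l = + count (selects i j l S′) L
    H₁⊕H≈ : H₁ ⊕ H ≈ λ _ i j l → + count (selects i j l S′) (r ∷ L)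
    H₁⊕H≈ _ i j l = sym (ℤ.pos-+ (𝟙 (selects i j l S′ r)) (count (selects i j l S′) L))
    cA = countCol isA r
    cC = countCol isC r
    cD = countCol isD r
    head : + 𝟙 (P r) ≡ (colour^ x · H₁) n i j l
    head = trans (𝟙-shift (λ z → z ∧ ((𝟙 (isC x) + cC ≡ᵇ j) ∧ ((𝟙 (isD x) + cD ≡ᵇ l) ∧ S′ r))) refl (isA x) cA i)
      (shift-cong (𝟙 (isA x)) (λ i′ →
        trans (𝟙-shift (λ z → (cA ≡ᵇ i′) ∧ (z ∧ ((𝟙 (isD x) + cD ≡ᵇ l) ∧ S′ r))) (∧-zeroʳ _) (isC x) cC j)
          (shift-cong (𝟙 (isC x)) (λ j′ →
            𝟙-shift (λ z → (cA ≡ᵇ i′) ∧ ((cC ≡ᵇ j′) ∧ (z ∧ S′ r)))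
                    (trans (cong ((cA ≡ᵇ i′) ∧_) (∧-zeroʳ _)) (∧-zeroʳ _)) (isD x) cD l) j)) i)

  module _ (k : ℕ) where

    gf : (List Part → Bool) → Series
    gf S n i j l = + count (selects i j l S) (seqs k n)

    G G⁺ : (Part → Bool) → Series
    G  φ = gf (λ λs → headFits  φ λs ∧ isPartition≤ k λs)
    G⁺ φ = gf (λ λs → headFits⁺ φ λs ∧ isPartition≤ k λs)

    gf-cong : ∀ {S S′} → (∀ λs → S λs ≡ S′ λs) → gf S ≈ gf S′
    gf-cong e n i j l = cong +_ (count-cong (seqs k n) λ λs →
      cong (λ s → (countCol isA λs ≡ᵇ i) ∧ ((countCol isC λs ≡ᵇ j) ∧ ((countCol isD λs ≡ᵇ l) ∧ s))) (e λs))

    gf-split : ∀ {S S₁ S₂} → (∀ λs → 𝟙 (S λs) ≡ 𝟙 (S₁ λs) + 𝟙 (S₂ λs)) → gf S ≈ gf S₁ ⊕ gf S₂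
    gf-split {S₁ = S₁} {S₂} e n i j l = trans
      (cong +_ (count-split (seqs k n) λ λs →
        𝟙-∧-split (countCol isA λs ≡ᵇ i) (𝟙-∧-split (countCol isC λs ≡ᵇ j) (𝟙-∧-split (countCol isD λs ≡ᵇ l) (e λs)))))
      (ℤ.pos-+ (count (selects i j l S₁) (seqs k n)) (count (selects i j l S₂) (seqs k n)))

    firstValues : ℕ → List ℕ
    firstValues n = filter (λ v → T? (suc v ≤ᵇ k ⊓ suc n)) (upTo (suc n))

    count-seqs-suc : ∀ (p : List Part → Bool) n → count p (seqs k (suc n)) ≡
      sum (map (λ v → sum (map (λ y → count (λ r → p ((suc v , y) ∷ r)) (seqsF k n (n ∸ v))) colours))
               (firstValues n))
    count-seqs-suc p n =
      trans (count-concatMap p _ (firstValues n))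
        (sum-map-cong (firstValues n) λ v → trans (count-concatMap p _ colours)
          (sum-map-cong colours λ y → count-map p ((suc v , y) ∷_) (seqsF k n (n ∸ v))))

    seqsF-fuel : ∀ f f′ n → n ≤ f → n ≤ f′ → seqsF k f n ≡ seqsF k f′ n
    seqsF-fuel zero    zero     zero    _         _          = refl
    seqsF-fuel zero    (suc f′) zero    _         _          = refl
    seqsF-fuel (suc f) zero     zero    _         _          = refl
    seqsF-fuel (suc f) (suc f′) zero    _         _          = refl
    seqsF-fuel (suc f) (suc f′) (suc n) (s≤s n≤f) (s≤s n≤f′) =
      List.concatMap-cong (λ v → List.concatMap-cong (λ x → cong (map ((suc v , x) ∷_))
        (seqsF-fuel f f′ (n ∸ v) (ℕ.≤-trans (ℕ.m∸n≤m n v) n≤f) (ℕ.≤-trans (ℕ.m∸n≤m n v) n≤f′))) colours)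
        (filter (λ v → T? (suc v ≤ᵇ k ⊓ suc n)) (upTo (suc n)))

    count-seqs-suc-none : ∀ {p : List Part → Bool} n → (∀ v y r → p ((suc v , y) ∷ r) ≡ false) →
                          count p (seqs k (suc n)) ≡ 0
    count-seqs-suc-none {p} n e = trans (count-seqs-suc p n)
      (sum-map-zero (firstValues n) λ v → sum-map-zero colours λ y → count-none (seqsF k n (n ∸ v)) (e v y))

    gf-null : gf (λ λs → null λs ∧ isPartition≤ k λs) ≈ oneS
    gf-null zero    zero    zero    zero    = refl
    gf-null zero    zero    zero    (suc l) = refl
    gf-null zero    zero    (suc j) l       = refl
    gf-null zero    (suc i) j       l       = refl
    gf-null (suc n) i       j       l       =
      cong +_ (count-seqs-suc-none n λ v y r →
        selects-false i j l (λ λs → null λs ∧ isPartition≤ k λs) ((suc v , y) ∷ r) refl)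

    G-unfold : ∀ φ → G φ ≈ oneS ⊕ G⁺ φ
    G-unfold φ = ≈-trans (gf-split λ { [] → refl ; (_ ∷ _) → refl }) (⊕-congˡ (G⁺ φ) gf-null)

    on-head : (Q : ℕ → Colour → Set) → (∀ v y → suc v ≤ k → Q (suc v) y) →
              ∀ m y r → T (isPartition≤ k ((m , y) ∷ r)) → Q m y
    on-head Q h zero    y r ()
    on-head Q h (suc v) y r valid =
      h v y (ℕ.≤ᵇ⇒≤ (suc v) k (proj₁ (Equivalence.to T-∧ (proj₁ (Equivalence.to T-∧ valid)))))

    G⁺-split : ∀ {φ ψ χ} → (∀ y v → 𝟙 (φ (suc v , y)) ≡ 𝟙 (ψ (suc v , y)) + 𝟙 (χ (suc v , y))) →
               G⁺ φ ≈ G⁺ ψ ⊕ G⁺ χ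
    G⁺-split {φ} {ψ} {χ} e = gf-split λ where
      []            → refl
      ((m , y) ∷ r) → 𝟙-∧-splitʳ (φ (m , y)) (ψ (m , y)) (χ (m , y)) (isPartition≤ k ((m , y) ∷ r))
        (on-head (λ m y → 𝟙 (φ (m , y)) ≡ 𝟙 (ψ (m , y)) + 𝟙 (χ (m , y))) (λ v y _ → e y v) m y r)

    G⁺-cong : ∀ {φ ψ} → (∀ y v → suc v ≤ k → φ (suc v , y) ≡ ψ (suc v , y)) → G⁺ φ ≈ G⁺ ψ
    G⁺-cong {φ} {ψ} e = gf-cong λ where
      []            → refl
      ((m , y) ∷ r) → ∧-congʳ (φ (m , y)) (ψ (m , y)) (isPartition≤ k ((m , y) ∷ r))
        (on-head (λ m y → φ (m , y) ≡ ψ (m , y)) (λ v y v≤k → e y v v≤k) m y r)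

    G-cong : ∀ {φ ψ} → (∀ y v → suc v ≤ k → φ (suc v , y) ≡ ψ (suc v , y)) → G φ ≈ G ψ
    G-cong {φ} {ψ} e = ≈-trans (G-unfold φ) (≈-trans (⊕-congʳ oneS (G⁺-cong e)) (≈-sym (G-unfold ψ)))

    gf≈G : gf (isPartition≤ k) ≈ G (λ _ → true)
    gf≈G = gf-cong (λ { [] → refl ; (_ ∷ _) → refl })

    G-none : ∀ {φ} → (∀ y v → φ (suc v , y) ≡ false) → G φ ≈ oneS
    G-none {φ} e n i j l = begin
      G φ n i j l                        ≡⟨ G-unfold φ n i j l ⟩
      oneS n i j l +ℤ G⁺ φ n i j l        ≡⟨ cong (oneS n i j l +ℤ_) (G⁺-cong (λ y v _ → e y v) n i j l) ⟩
      oneS n i j l +ℤ G⁺ (λ _ → false) n i j l ≡⟨ cong (λ z → oneS n i j l +ℤ + z)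
                                                    (count-none (seqs k n) λ λs → selects-false i j l S λs (none λs)) ⟩
      oneS n i j l +ℤ + 0                 ≡⟨ ℤ.+-identityʳ (oneS n i j l) ⟩
      oneS n i j l                        ∎
      where
      open ≡-Reasoning
      S : List Part → Bool
      S λs = headFits⁺ (λ _ → false) λs ∧ isPartition≤ k λs
      none : ∀ λs → S λs ≡ false
      none []      = refl
      none (_ ∷ _) = refl

    isPartition-cons : ∀ w x r → suc w ≤ k →
      isPartition≤ k ((suc w , x) ∷ r) ≡ headFits (compat (suc w , x)) r ∧ isPartition≤ k r
    isPartition-cons w x r w<k rewrite Equivalence.to T-≡ (ℕ.≤⇒≤ᵇ w<k) | consec-cons (suc w , x) r =
      ∧-left-comm (boundedAll k r) (headFits (compat (suc w , x)) r) (consec r)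

    module _ {w n : ℕ} (f : ℕ → ℕ) where

      private
        h : ℕ → ℕ
        h v = if v ≡ᵇ w then f v else 0

        p : ℕ → Bool
        p v = suc v ≤ᵇ k ⊓ suc n

        off-w : ∀ v → v ≢ w → (if p v then h v else 0) ≡ 0
        off-w v v≢w rewrite ≢⇒≡ᵇ-false v≢w with p v
        ... | true  = refl
        ... | false = refl

      firstValues-inside : w ≤ n → suc w ≤ k → sum (map h (firstValues n)) ≡ f w
      firstValues-inside w≤n w<k = begin
        sum (map h (firstValues n))                              ≡⟨ sum-filter h p (upTo (suc n)) ⟩
        sum (map (λ v → if p v then h v else 0) (upTo (suc n))) ≡⟨ sum-upTo-inside off-w (suc n) (s≤s w≤n) ⟩
        (if p w then h w else 0)                                 ≡⟨ cong (λ z → if z then h w else 0) p-w ⟩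
        h w                                                      ≡⟨ cong (λ z → if z then f w else 0) (≡ᵇ-refl w) ⟩
        f w                                                      ∎
        where
        open ≡-Reasoning
        p-w : p w ≡ true
        p-w = Equivalence.to T-≡ (ℕ.≤⇒≤ᵇ (ℕ.⊓-glb w<k (s≤s w≤n)))

      firstValues-outside : n < w → sum (map h (firstValues n)) ≡ 0
      firstValues-outside n<w = trans (sum-filter h p (upTo (suc n))) (sum-upTo-outside off-w (suc n) n<w)

    private module FirstPart (w : ℕ) (x : Colour) (n i j l : ℕ) where

      S⁺ : List Part → Bool
      S⁺ λs = headFits⁺ (_≐ (suc w , x)) λs ∧ isPartition≤ k λs
      Q : ℕ → List Part → Bool
      Q v r = selects i j l (isPartition≤ k) ((suc v , x) ∷ r)
      by-first-part : count (selects i j l S⁺) (seqs k (suc n)) ≡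
                      sum (map (λ v → if v ≡ᵇ w then count (Q v) (seqsF k n (n ∸ v)) else 0) (firstValues n))
      by-first-part = trans (count-seqs-suc (selects i j l S⁺) n) (sum-map-cong (firstValues n) λ v →
        trans (sum-map-cong colours λ y →
          trans (count-cong (seqsF k n (n ∸ v)) λ r →
                   trans (selects-guard i j l ((rank y ≡ᵇ rank x) ∧ (v ≡ᵇ w)) (isPartition≤ k) ((suc v , y) ∷ r))
                         (∧-assoc (rank y ≡ᵇ rank x) (v ≡ᵇ w) _))
          (trans (count-guard (rank y ≡ᵇ rank x) _ (seqsF k n (n ∸ v)))
                 (cong (λ z → if rank y ≡ᵇ rank x then z else 0) (count-guard (v ≡ᵇ w) _ (seqsF k n (n ∸ v))))))
        (sum-colours (λ y → if v ≡ᵇ w then count (λ r → Q′ v y r) (seqsF k n (n ∸ v)) else 0) x))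
        where
        Q′ : ℕ → Colour → List Part → Bool
        Q′ v y r = selects i j l (isPartition≤ k) ((suc v , y) ∷ r)


    G⁺-single : ∀ w x → suc w ≤ k → G⁺ (_≐ (suc w , x)) ≈ ⟦ suc w , x ⟧· G (compat (suc w , x))
    G⁺-single w x w<k zero    i j l =
      trans (cong (λ z → + (𝟙 z + 0)) (selects-false i j l (FirstPart.S⁺ w x 0 i j l) [] refl))
            (sym (colour^-vanish x (q^ suc w · G (compat (suc w , x))) 0 i j l (λ _ _ _ → refl)))
    G⁺-single w x w<k (suc n) i j l with ℕ.≤-<-connex w n
    ... | inj₁ w≤n = begin
      + count (selects i j l S⁺) (seqs k (suc n))     ≡⟨ cong +_ (trans by-first-part (firstValues-inside _ w≤n w<k)) ⟩
      + count (Q w) (seqsF k n (n ∸ w))               ≡⟨ count-cons (suc w) x (isPartition≤ k) (seqsF k n (n ∸ w)) (suc n) i j l ⟩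
      (colour^ x · H) (suc n) i j l                   ≡⟨ lin-cong (colour^-linear x) H≈ (suc n) i j l ⟩
      (⟦ suc w , x ⟧· G (compat (suc w , x))) (suc n) i j l ∎
      where
      open ≡-Reasoning
      open FirstPart w x n i j l
      u = (suc w , x)
      H : Series
      H _ i j l = + count (selects i j l (λ r → isPartition≤ k (u ∷ r))) (seqsF k n (n ∸ w))
      H≈ : H ≈ λ _ i j l → (q^ suc w · G (compat u)) (suc n) i j l
      H≈ _ i j l = begin
        H 0 i j l ≡⟨ cong +_ (count-cong (seqsF k n (n ∸ w)) λ r →
                       cong (λ z → (countCol isA r ≡ᵇ i) ∧ ((countCol isC r ≡ᵇ j) ∧ ((countCol isD r ≡ᵇ l) ∧ z)))
                            (isPartition-cons w x r w<k)) ⟩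
        + count (selects i j l (λ r → headFits (compat u) r ∧ isPartition≤ k r)) (seqsF k n (n ∸ w))
                  ≡⟨ cong (λ L → + count (selects i j l (λ r → headFits (compat u) r ∧ isPartition≤ k r)) L)
                          (seqsF-fuel n (n ∸ w) (n ∸ w) (ℕ.m∸n≤m n w) ℕ.≤-refl) ⟩
        G (compat u) (n ∸ w) i j l
                  ≡⟨ shift-≤ w (λ n′ → G (compat u) n′ i j l) n w≤n ⟨
        (q^ suc w · G (compat u)) (suc n) i j l ∎
    ... | inj₂ n<w = trans (cong +_ (trans by-first-part (firstValues-outside _ n<w)))
                           (sym (colour^-vanish x (q^ suc w · G (compat (suc w , x))) (suc n) i j l λ i′ j′ l′ →
                             shift-> w (λ n′ → G (compat (suc w , x)) n′ i′ j′ l′) n n<w))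
      where open FirstPart w x n i j l

    G-insert : ∀ {φ ψ} w x → suc w ≤ k →
      (∀ y v → 𝟙 (φ (suc v , y)) ≡ 𝟙 (ψ (suc v , y)) + 𝟙 ((suc v , y) ≐ (suc w , x))) →
      G φ ≈ G ψ ⊕ ⟦ suc w , x ⟧· G (compat (suc w , x))
    G-insert {φ} {ψ} w x w<k e = begin
      G φ                                                     ≈⟨ G-unfold φ ⟩
      oneS ⊕ G⁺ φ                                             ≈⟨ ⊕-congʳ oneS (G⁺-split e) ⟩
      oneS ⊕ (G⁺ ψ ⊕ G⁺ (_≐ (suc w , x)))                     ≈⟨ (λ n i j l → sym (ℤ.+-assoc (oneS n i j l) _ _)) ⟩
      (oneS ⊕ G⁺ ψ) ⊕ G⁺ (_≐ (suc w , x))                     ≈⟨ ⊕-cong (≈-sym (G-unfold ψ)) (G⁺-single w x w<k) ⟩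
      G ψ ⊕ ⟦ suc w , x ⟧· G (compat (suc w , x))             ∎
      where open ≈-Reasoning

-- Comparisons of v and m are invariant under shifting both, so an identity in
-- (v , m) only has to be checked near the axes; for the identities below these
-- base cases hold by computation and are found by instance search.
instance
  ≡-refl : ∀ {A : Set} {x : A} → x ≡ x
  ≡-refl = refl

byDiagonal : {P : ℕ → ℕ → Set} → (∀ {v m} → P v m → P (suc v) (suc m)) →
  {{P 0 0}} → {{P 0 1}} → {{P 0 2}} → {{∀ {m} → P 0 (3 + m)}} →
  {{P 1 0}} → {{P 2 0}} → {{∀ {v} → P (3 + v) 0}} → ∀ v m → P v m
byDiagonal step {{p}} {{_}} {{_}} {{_}} {{_}} {{_}} {{_}} zero zero                = p
byDiagonal step {{_}} {{p}} {{_}} {{_}} {{_}} {{_}} {{_}} zero (suc zero)          = p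
byDiagonal step {{_}} {{_}} {{p}} {{_}} {{_}} {{_}} {{_}} zero (suc (suc zero))    = p
byDiagonal step {{_}} {{_}} {{_}} {{p}} {{_}} {{_}} {{_}} zero (suc (suc (suc m))) = p
byDiagonal step {{_}} {{_}} {{_}} {{_}} {{p}} {{_}} {{_}} (suc zero) zero          = p
byDiagonal step {{_}} {{_}} {{_}} {{_}} {{_}} {{p}} {{_}} (suc (suc zero)) zero    = p
byDiagonal step {{_}} {{_}} {{_}} {{_}} {{_}} {{_}} {{p}} (suc (suc (suc v))) zero = p
byDiagonal {P} step (suc v) (suc m) = step (byDiagonal {P} step v m)

-- Capparelli partitions

sum-colours-C : ∀ (g : CCol → ℕ) x →
  sum (map (λ y → if rankC y ≡ᵇ rankC x then g y else 0) (a ∷ c ∷ d ∷ [])) ≡ g x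
sum-colours-C g a = ℕ.+-identityʳ (g a)
sum-colours-C g c = ℕ.+-identityʳ (g c)
sum-colours-C g d = ℕ.+-identityʳ (g d)

module CapSeries = PartitionSeries CCol (a ∷ c ∷ d ∷ []) rankC gapC isA-C isC isD-C sum-colours-C

module Capparelli where
  open CapSeries

  pred-a : ∀ y v m → 𝟙 ((suc m , a) ≥P (suc v , y)) ≡ 𝟙 ((m , d) ≥P (suc v , y)) + 𝟙 ((suc v , y) ≐ (suc m , a))
  pred-a = λ { a → byDiagonal id ; c → byDiagonal id ; d → byDiagonal id }

  pred-c : ∀ y v m → 𝟙 ((suc m , c) ≥P (suc v , y)) ≡ 𝟙 ((suc m , a) ≥P (suc v , y)) + 𝟙 ((suc v , y) ≐ (suc m , c))
  pred-c = λ { a → byDiagonal id ; c → byDiagonal id ; d → byDiagonal id }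

  pred-d : ∀ y v m → 𝟙 ((suc m , d) ≥P (suc v , y)) ≡ 𝟙 ((suc m , c) ≥P (suc v , y)) + 𝟙 ((suc v , y) ≐ (suc m , d))
  pred-d = λ { a → byDiagonal id ; c → byDiagonal id ; d → byDiagonal id }

  compat-a : ∀ y v m → compat (suc (suc m) , a) (suc v , y) ≡ (m , d) ≥P (suc v , y)
  compat-a = λ { a → byDiagonal id ; c → byDiagonal id ; d → byDiagonal id }

  compat-c : ∀ y v m → compat (suc m , c) (suc v , y) ≡ (m , c) ≥P (suc v , y)
  compat-c = λ { a → byDiagonal id ; c → byDiagonal id ; d → byDiagonal id }

  compat-d : ∀ y v m → 𝟙 (compat (suc m , d) (suc v , y)) ≡ 𝟙 ((m , c) ≥P (suc v , y)) + 𝟙 ((suc v , y) ≐ (suc m , a))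
  compat-d = λ { a → byDiagonal id ; c → byDiagonal id ; d → byDiagonal id }

  compat-a₁ : ∀ y v → compat (1 , a) (suc v , y) ≡ false
  compat-a₁ a zero    = refl
  compat-a₁ c zero    = refl
  compat-a₁ d zero    = refl
  compat-a₁ y (suc v) = refl

  ≥P-top : ∀ y v m → suc v ≤ m → (m , d) ≥P (suc v , y) ≡ true
  ≥P-top a zero    (suc zero)    _         = refl
  ≥P-top c zero    (suc zero)    _         = refl
  ≥P-top d zero    (suc zero)    _         = refl
  ≥P-top y zero    (suc (suc m)) _         = refl
  ≥P-top y (suc v) (suc m)       (s≤s v<m) = ≥P-top y v m v<m

  module _ (k : ℕ) where

    F M L : ℕ → Series
    F m = G k ((m , d) ≥P_)
    M m = G k ((m , c) ≥P_)
    L m = G k (compat (suc m , a))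

    recurrence : CapparelliRecurrence k F M L
    recurrence = record
      { F-suc = λ m m<k → begin
          F (suc m)                                           ≈⟨ G-insert k m d m<k (λ y v → pred-d y v m) ⟩
          M (suc m) ⊕ dq^ suc m · G k (compat (suc m , d))    ≈⟨ ⊕-congʳ (M (suc m)) (lin-cong (dq^-linear (suc m))
                                                                   (G-insert k m a m<k (λ y v → compat-d y v m))) ⟩
          M (suc m) ⊕ dq^ suc m · (M m ⊕ aq^ suc m · L m)     ∎
      ; M-suc = λ m m<k → begin
          M (suc m)                                              ≈⟨ G-insert k m c m<k (λ y v → pred-c y v m) ⟩
          G k ((suc m , a) ≥P_) ⊕ cq^ suc m · G k (compat (suc m , c))
                                                                 ≈⟨ ⊕-cong (G-insert k m a m<k (λ y v → pred-a y v m))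
                                                                      (lin-cong (cq^-linear (suc m)) (G-cong k (λ y v _ → compat-c y v m))) ⟩
          (F m ⊕ aq^ suc m · L m) ⊕ cq^ suc m · M m              ∎
      ; L-suc = λ m → G-cong k (λ y v _ → compat-a y v m)
      }
      where open ≈-Reasoning

    F₀ : F 0 ≈ oneS
    F₀ = G-none k (λ _ _ → refl)

    M₀ : M 0 ≈ oneS
    M₀ = G-none k (λ _ _ → refl)

    L₀ : L 0 ≈ oneS
    L₀ = G-none k compat-a₁

    GC≈gf : GC k ≈ gf k (isPartition≤ k)
    GC≈gf n i j l = cong +_ (trans (length-filter-filter _ _ (seqs k n)) (count-cong (seqs k n) λ λs →
      ∧-rotate (isPartition≤ k λs) (countCol isA-C λs ≡ᵇ i) (countCol isC λs ≡ᵇ j) (countCol isD-C λs ≡ᵇ l)))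

    GC≈F : GC k ≈ F k
    GC≈F = begin
      GC k                  ≈⟨ GC≈gf ⟩
      gf k (isPartition≤ k) ≈⟨ gf≈G k ⟩
      G k (λ _ → true)      ≈⟨ G-cong k (λ y v v<k → sym (≥P-top y v k v<k)) ⟩
      F k                   ∎
      where open ≈-Reasoning

sumTo-count : ∀ {A : Set} j (p : ℕ → A → Bool) (q : A → Bool) xs →
  (∀ x → sumTo j (λ h → + 𝟙 (p h x)) ≡ + 𝟙 (q x)) → sumTo j (λ h → + count (p h) xs) ≡ + count q xs
sumTo-count j p q []       e = sumTo-vanish j λ _ → refl
sumTo-count j p q (x ∷ xs) e = begin
  sumTo j (λ h → + (𝟙 (p h x) + count (p h) xs))            ≡⟨ sumTo-cong j (λ h _ → ℤ.pos-+ (𝟙 (p h x)) _) ⟩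
  sumTo j (λ h → + 𝟙 (p h x) +ℤ + count (p h) xs)           ≡⟨ sumTo-+ j _ _ ⟩
  sumTo j (λ h → + 𝟙 (p h x)) +ℤ sumTo j (λ h → + count (p h) xs) ≡⟨ cong₂ _+ℤ_ (e x) (sumTo-count j p q xs e) ⟩
  + 𝟙 (q x) +ℤ + count q xs                                 ≡⟨ ℤ.pos-+ (𝟙 (q x)) (count q xs) ⟨
  + (𝟙 (q x) + count q xs)                                  ∎
  where open ≡-Reasoning

+-≡ᵇ : ∀ B C j → B ≤ j → (B + C ≡ᵇ j) ≡ (C ≡ᵇ j ∸ B)
+-≡ᵇ zero    C j       _         = refl
+-≡ᵇ (suc B) C (suc j) (s≤s B≤j) = +-≡ᵇ B C j B≤j

+-≡ᵇ-> : ∀ B C j → j < B → (B + C ≡ᵇ j) ≡ false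
+-≡ᵇ-> (suc B) C zero    _         = refl
+-≡ᵇ-> (suc B) C (suc j) (s≤s j<B) = +-≡ᵇ-> B C j j<B

sumTo-split : ∀ g B C j → sumTo j (λ h → + 𝟙 (g ∧ ((B ≡ᵇ h) ∧ (C ≡ᵇ j ∸ h)))) ≡ + 𝟙 (g ∧ (B + C ≡ᵇ j))
sumTo-split false B C j = sumTo-vanish j λ _ → refl
sumTo-split true  B C j with ℕ.≤-<-connex B j
... | inj₁ B≤j = begin
  sumTo j (λ h → + 𝟙 ((B ≡ᵇ h) ∧ (C ≡ᵇ j ∸ h)))  ≡⟨ sumTo-single j (λ h _ h≢B → cong (λ z → + 𝟙 (z ∧ (C ≡ᵇ j ∸ h)))
                                                     (≢⇒≡ᵇ-false {B} {h} (λ B≡h → h≢B (sym B≡h)))) B≤j ⟩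
  + 𝟙 ((B ≡ᵇ B) ∧ (C ≡ᵇ j ∸ B))                  ≡⟨ cong (λ z → + 𝟙 (z ∧ (C ≡ᵇ j ∸ B))) (≡ᵇ-refl B) ⟩
  + 𝟙 (C ≡ᵇ j ∸ B)                               ≡⟨ cong (λ z → + 𝟙 z) (+-≡ᵇ B C j B≤j) ⟨
  + 𝟙 (B + C ≡ᵇ j)                               ∎
  where open ≡-Reasoning
... | inj₂ j<B = trans (trans (sumTo-cong j λ h h≤j → cong (λ z → + 𝟙 (z ∧ (C ≡ᵇ j ∸ h)))
                                  (≢⇒≡ᵇ-false {B} {h} (λ B≡h → ℕ.<-irrefl (sym B≡h) (ℕ.≤-<-trans h≤j j<B))))
                              (sumTo-vanish j λ _ → refl))
                       (cong (λ z → + 𝟙 z) (sym (+-≡ᵇ-> B C j j<B)))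

∧-shuffle₁ : ∀ p x e f z → p ∧ (x ∧ (e ∧ (f ∧ z))) ≡ (x ∧ (z ∧ p)) ∧ (e ∧ f)
∧-shuffle₁ false x e f z rewrite ∧-zeroʳ z | ∧-zeroʳ x = refl
∧-shuffle₁ true  false e f z = refl
∧-shuffle₁ true  true  e f false = trans (cong (e ∧_) (∧-zeroʳ f)) (∧-zeroʳ e)
∧-shuffle₁ true  true  e f true  = cong (e ∧_) (∧-identityʳ f)

∧-shuffle₂ : ∀ x s z p → x ∧ (s ∧ (z ∧ p)) ≡ (x ∧ (z ∧ p)) ∧ s
∧-shuffle₂ false s z p = refl
∧-shuffle₂ true  s z p = ∧-comm s (z ∧ p)

-- Primc partitions

sum-colours-P : ∀ (g : PCol → ℕ) x →
  sum (map (λ y → if rankP y ≡ᵇ rankP x then g y else 0) (a ∷ b ∷ c ∷ d ∷ [])) ≡ g x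
sum-colours-P g a = ℕ.+-identityʳ (g a)
sum-colours-P g b = ℕ.+-identityʳ (g b)
sum-colours-P g c = ℕ.+-identityʳ (g c)
sum-colours-P g d = ℕ.+-identityʳ (g d)

-- Parts of colour b are counted by the exponent of c: this is the specialisation b = c.
isBC-P : PCol → Bool
isBC-P x = isB-P x ∨ isC-P x

module PriSeries = PartitionSeries PCol (a ∷ b ∷ c ∷ d ∷ []) rankP gapP isA-P isBC-P isD-P sum-colours-P

module Primc where
  open PriSeries

  pred-a : ∀ y v m → 𝟙 ((suc m , a) ≥P (suc v , y)) ≡ 𝟙 ((m , d) ≥P (suc v , y)) + 𝟙 ((suc v , y) ≐ (suc m , a))
  pred-a = λ { a → byDiagonal id ; b → byDiagonal id ; c → byDiagonal id ; d → byDiagonal id }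

  pred-b : ∀ y v m → 𝟙 ((suc m , b) ≥P (suc v , y)) ≡ 𝟙 ((suc m , a) ≥P (suc v , y)) + 𝟙 ((suc v , y) ≐ (suc m , b))
  pred-b = λ { a → byDiagonal id ; b → byDiagonal id ; c → byDiagonal id ; d → byDiagonal id }

  pred-c : ∀ y v m → 𝟙 ((suc m , c) ≥P (suc v , y)) ≡ 𝟙 ((suc m , b) ≥P (suc v , y)) + 𝟙 ((suc v , y) ≐ (suc m , c))
  pred-c = λ { a → byDiagonal id ; b → byDiagonal id ; c → byDiagonal id ; d → byDiagonal id }

  pred-d : ∀ y v m → 𝟙 ((suc m , d) ≥P (suc v , y)) ≡ 𝟙 ((suc m , c) ≥P (suc v , y)) + 𝟙 ((suc v , y) ≐ (suc m , d))
  pred-d = λ { a → byDiagonal id ; b → byDiagonal id ; c → byDiagonal id ; d → byDiagonal id }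

  compat-b : ∀ y v m → 𝟙 (compat (suc m , b) (suc v , y)) ≡ 𝟙 ((m , d) ≥P (suc v , y)) + 𝟙 ((suc v , y) ≐ (suc m , b))
  compat-b = λ { a → byDiagonal id ; b → byDiagonal id ; c → byDiagonal id ; d → byDiagonal id }

  compat-a : ∀ y v m →
    𝟙 (compat (suc (suc m) , a) (suc v , y)) ≡ 𝟙 ((m , d) ≥P (suc v , y)) + 𝟙 ((suc v , y) ≐ (suc m , b))
  compat-a = λ { a → byDiagonal id ; b → byDiagonal id ; c → byDiagonal id ; d → byDiagonal id }

  c-or-a : ℕ → Part → Bool
  c-or-a m q = ((m , c) ≥P q) ∨ (q ≐ (suc m , a))

  compat-c : ∀ y v m → 𝟙 (compat (suc m , c) (suc v , y)) ≡ 𝟙 (c-or-a m (suc v , y)) + 𝟙 ((suc v , y) ≐ (suc m , c))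
  compat-c = λ { a → byDiagonal id ; b → byDiagonal id ; c → byDiagonal id ; d → byDiagonal id }

  c-or-a-disjoint : ∀ y v m →
    𝟙 (c-or-a m (suc v , y)) ≡ 𝟙 ((m , c) ≥P (suc v , y)) + 𝟙 ((suc v , y) ≐ (suc m , a))
  c-or-a-disjoint = λ { a → byDiagonal id ; b → byDiagonal id ; c → byDiagonal id ; d → byDiagonal id }

  compat-d : ∀ y v m → compat (suc m , d) (suc v , y) ≡ compat (suc m , c) (suc v , y)
  compat-d = λ { a → byDiagonal id ; b → byDiagonal id ; c → byDiagonal id ; d → byDiagonal id }

  compat-a₁ : ∀ y v → compat (1 , a) (suc v , y) ≡ false
  compat-a₁ a zero    = refl
  compat-a₁ b zero    = refl
  compat-a₁ c zero    = refl
  compat-a₁ d zero    = refl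
  compat-a₁ y (suc v) = refl

  ≥P-top : ∀ y v m → suc v ≤ m → (m , d) ≥P (suc v , y) ≡ true
  ≥P-top a zero    (suc zero)    _         = refl
  ≥P-top b zero    (suc zero)    _         = refl
  ≥P-top c zero    (suc zero)    _         = refl
  ≥P-top d zero    (suc zero)    _         = refl
  ≥P-top y zero    (suc (suc m)) _         = refl
  ≥P-top y (suc v) (suc m)       (s≤s v<m) = ≥P-top y v m v<m

  module _ (k : ℕ) where

    F M L Lb Lc : ℕ → Series
    F m = G k ((m , d) ≥P_)
    M m = G k ((m , c) ≥P_)
    L m = G k (compat (suc m , a))
    Lb m = G k (compat (suc m , b))
    Lc m = G k (compat (suc m , c))

    module _ (m : ℕ) (m<k : suc m ≤ k) where

      Lb-fix : Lb m ≈ F m ⊕ cq^ suc m · Lb m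
      Lb-fix = G-insert k m b m<k (λ y v → compat-b y v m)

      Lc-solve : 1-cq^ suc m · Lc m ≈ M m ⊕ aq^ suc m · L m
      Lc-solve = begin
        1-cq^ suc m · Lc m   ≈⟨ 1-cq^-fix (suc m) {F = G k (c-or-a m)} (G-insert k m c m<k (λ y v → compat-c y v m)) ⟩
        G k (c-or-a m)       ≈⟨ G-insert k m a m<k (λ y v → c-or-a-disjoint y v m) ⟩
        M m ⊕ aq^ suc m · L m ∎
        where open ≈-Reasoning

      M-expand : M (suc m) ≈ ((F m ⊕ aq^ suc m · L m) ⊕ cq^ suc m · Lb m) ⊕ cq^ suc m · Lc m
      M-expand = begin
        M (suc m)                                                  ≈⟨ G-insert k m c m<k (λ y v → pred-c y v m) ⟩
        G k ((suc m , b) ≥P_) ⊕ cq^ suc m · Lc m                   ≈⟨ ⊕-congˡ (cq^ suc m · Lc m)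
                                                                       (G-insert k m b m<k (λ y v → pred-b y v m)) ⟩
        (G k ((suc m , a) ≥P_) ⊕ cq^ suc m · Lb m) ⊕ cq^ suc m · Lc m ≈⟨ ⊕-congˡ (cq^ suc m · Lc m) (⊕-congˡ (cq^ suc m · Lb m)
                                                                       (G-insert k m a m<k (λ y v → pred-a y v m))) ⟩
        ((F m ⊕ aq^ suc m · L m) ⊕ cq^ suc m · Lb m) ⊕ cq^ suc m · Lc m ∎
        where open ≈-Reasoning

    recurrence : PrimcRecurrence k F M L
    recurrence = record
      { F-suc = λ m m<k → begin
          1-cq^ suc m · F (suc m)
            ≈⟨ lin-cong (1-cq^-linear (suc m)) (G-insert k m d m<k (λ y v → pred-d y v m)) ⟩
          1-cq^ suc m · (M (suc m) ⊕ dq^ suc m · G k (compat (suc m , d)))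
            ≈⟨ lin-⊕ (1-cq^-linear (suc m)) (M (suc m)) (dq^ suc m · G k (compat (suc m , d))) ⟩
          1-cq^ suc m · M (suc m) ⊕ 1-cq^ suc m · dq^ suc m · G k (compat (suc m , d))
            ≈⟨ ⊕-congʳ (1-cq^ suc m · M (suc m)) (1-cq^-dq^ (suc m) (suc m) (G k (compat (suc m , d)))) ⟩
          1-cq^ suc m · M (suc m) ⊕ dq^ suc m · 1-cq^ suc m · G k (compat (suc m , d))
            ≈⟨ ⊕-congʳ (1-cq^ suc m · M (suc m)) (lin-cong (∘-linear (dq^-linear (suc m)) (1-cq^-linear (suc m)))
                 (G-cong k (λ y v _ → compat-d y v m))) ⟩
          1-cq^ suc m · M (suc m) ⊕ dq^ suc m · 1-cq^ suc m · Lc m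
            ≈⟨ ⊕-congʳ (1-cq^ suc m · M (suc m)) (lin-cong (dq^-linear (suc m)) (Lc-solve m m<k)) ⟩
          1-cq^ suc m · M (suc m) ⊕ dq^ suc m · (M m ⊕ aq^ suc m · L m) ∎
      ; M-suc = λ m m<k → begin
          1-cq^ suc m · M (suc m)
            ≈⟨ lin-cong (1-cq^-linear (suc m)) (M-expand m m<k) ⟩
          1-cq^ suc m · (((F m ⊕ aq^ suc m · L m) ⊕ cq^ suc m · Lb m) ⊕ cq^ suc m · Lc m)
            ≈⟨ 1-cq^-⊕-cq^ (suc m) ((F m ⊕ aq^ suc m · L m) ⊕ cq^ suc m · Lb m) (Lc m) ⟩
          1-cq^ suc m · ((F m ⊕ aq^ suc m · L m) ⊕ cq^ suc m · Lb m) ⊕ cq^ suc m · 1-cq^ suc m · Lc m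
            ≈⟨ ⊕-cong (1-cq^-⊕-cq^ (suc m) (F m ⊕ aq^ suc m · L m) (Lb m))
                      (lin-cong (cq^-linear (suc m)) (Lc-solve m m<k)) ⟩
          (1-cq^ suc m · (F m ⊕ aq^ suc m · L m) ⊕ cq^ suc m · 1-cq^ suc m · Lb m) ⊕ cq^ suc m · (M m ⊕ aq^ suc m · L m)
            ≈⟨ ⊕-congˡ (cq^ suc m · (M m ⊕ aq^ suc m · L m)) (⊕-congʳ (1-cq^ suc m · (F m ⊕ aq^ suc m · L m))
                 (lin-cong (cq^-linear (suc m)) (1-cq^-fix (suc m) (Lb-fix m m<k)))) ⟩
          (1-cq^ suc m · (F m ⊕ aq^ suc m · L m) ⊕ cq^ suc m · F m) ⊕ cq^ suc m · (M m ⊕ aq^ suc m · L m)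
            ≈⟨ regroup (suc m) (F m) (aq^ suc m · L m) (M m) ⟩
          (F m ⊕ aq^ suc m · L m) ⊕ cq^ suc m · M m ∎
      ; L-suc = λ m m<k → begin
          1-cq^ suc m · L (suc m)
            ≈⟨ lin-cong (1-cq^-linear (suc m)) (G-insert k m b m<k (λ y v → compat-a y v m)) ⟩
          1-cq^ suc m · (F m ⊕ cq^ suc m · Lb m)
            ≈⟨ 1-cq^-⊕-cq^ (suc m) (F m) (Lb m) ⟩
          1-cq^ suc m · F m ⊕ cq^ suc m · 1-cq^ suc m · Lb m
            ≈⟨ ⊕-congʳ (1-cq^ suc m · F m) (lin-cong (cq^-linear (suc m)) (1-cq^-fix (suc m) (Lb-fix m m<k))) ⟩
          1-cq^ suc m · F m ⊕ cq^ suc m · F m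
            ≈⟨ 1-cq^-cancel (suc m) (F m) ⟩
          F m ∎
      }
      where
      open ≈-Reasoning
      regroup : ∀ s A B C → (1-cq^ s · (A ⊕ B) ⊕ cq^ s · A) ⊕ cq^ s · (C ⊕ B) ≈ (A ⊕ B) ⊕ cq^ s · C
      regroup s A B C n i j l rewrite lin-⊕ (cq^-linear s) A B n i j l | lin-⊕ (cq^-linear s) C B n i j l =
        ring (A n i j l +ℤ B n i j l) ((cq^ s · A) n i j l) ((cq^ s · B) n i j l) ((cq^ s · C) n i j l)
        where
        ring : ∀ w x y z → ((w -ℤ (x +ℤ y)) +ℤ x) +ℤ (z +ℤ y) ≡ w +ℤ z
        ring = solve-∀

    F₀ : F 0 ≈ oneS
    F₀ = G-none k (λ _ _ → refl)

    M₀ : M 0 ≈ oneS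
    M₀ = G-none k (λ _ _ → refl)

    L₀ : L 0 ≈ oneS
    L₀ = G-none k compat-a₁

    countCol-bc : ∀ λs → countCol isBC-P λs ≡ countCol isB-P λs + countCol isC-P λs
    countCol-bc []            = refl
    countCol-bc ((_ , a) ∷ r) = countCol-bc r
    countCol-bc ((_ , b) ∷ r) = cong suc (countCol-bc r)
    countCol-bc ((_ , c) ∷ r) = trans (cong suc (countCol-bc r)) (sym (ℕ.+-suc _ _))
    countCol-bc ((_ , d) ∷ r) = countCol-bc r

    GP-b=c≈gf : GP-b=c k ≈ gf k (isPartition≤ k)
    GP-b=c≈gf n i j l =
      trans (sumTo-cong j (λ h _ → cong +_ (length-filter-filter (isPartition≤ k) (tests h) (seqs k n))))
            (sumTo-count j _ _ (seqs k n) merge)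
      where
      tests : ℕ → List Part → Bool
      tests h λs = (countCol isA-P λs ≡ᵇ i) ∧ ((countCol isB-P λs ≡ᵇ h) ∧
                     ((countCol isC-P λs ≡ᵇ j ∸ h) ∧ (countCol isD-P λs ≡ᵇ l)))
      merge : ∀ λs → sumTo j (λ h → + 𝟙 (isPartition≤ k λs ∧ tests h λs)) ≡ + 𝟙 (selects i j l (isPartition≤ k) λs)
      merge λs = begin
        sumTo j (λ h → + 𝟙 (P ∧ (A ∧ ((countCol isB-P λs ≡ᵇ h) ∧ ((countCol isC-P λs ≡ᵇ j ∸ h) ∧ D)))))
          ≡⟨ sumTo-cong j (λ h _ → cong (λ z → + 𝟙 z)
               (∧-shuffle₁ P A (countCol isB-P λs ≡ᵇ h) (countCol isC-P λs ≡ᵇ j ∸ h) D)) ⟩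
        sumTo j (λ h → + 𝟙 ((A ∧ (D ∧ P)) ∧ ((countCol isB-P λs ≡ᵇ h) ∧ (countCol isC-P λs ≡ᵇ j ∸ h))))
          ≡⟨ sumTo-split (A ∧ (D ∧ P)) (countCol isB-P λs) (countCol isC-P λs) j ⟩
        + 𝟙 ((A ∧ (D ∧ P)) ∧ (countCol isB-P λs + countCol isC-P λs ≡ᵇ j))
          ≡⟨ cong (λ z → + 𝟙 ((A ∧ (D ∧ P)) ∧ (z ≡ᵇ j))) (countCol-bc λs) ⟨
        + 𝟙 ((A ∧ (D ∧ P)) ∧ (countCol isBC-P λs ≡ᵇ j))
          ≡⟨ cong (λ z → + 𝟙 z) (∧-shuffle₂ A (countCol isBC-P λs ≡ᵇ j) D P) ⟨
        + 𝟙 (selects i j l (isPartition≤ k) λs) ∎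
        where
        open ≡-Reasoning
        P = isPartition≤ k λs
        A = countCol isA-P λs ≡ᵇ i
        D = countCol isD-P λs ≡ᵇ l

    GP-b=c≈F : GP-b=c k ≈ F k
    GP-b=c≈F = begin
      GP-b=c k                 ≈⟨ GP-b=c≈gf ⟩
      gf k (isPartition≤ k)    ≈⟨ gf≈G k ⟩
      G k (λ _ → true)         ≈⟨ G-cong k (λ y v v<k → sym (≥P-top y v k v<k)) ⟩
      F k                      ∎
      where open ≈-Reasoning

theorem1p9 : (k : ℕ) → 1 ≤ k →
    ∀ n i j l → GC k n i j l ≡ (poch-cq k ⊛ GP-b=c k) n i j l
theorem1p9 k _ = begin
  GC k                  ≈⟨ Capparelli.GC≈F k ⟩
  Capparelli.F k k      ≈⟨ proj₁ (recurrence-transfer (Capparelli.recurrence k) (Primc.recurrence k)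
                                    (≈-trans (Capparelli.F₀ k) (≈-sym (Primc.F₀ k)))
                                    (≈-trans (Capparelli.M₀ k) (≈-sym (Primc.M₀ k)))
                                    (≈-trans (Capparelli.L₀ k) (≈-sym (Primc.L₀ k))) k ℕ.≤-refl) ⟩
  poch k · Primc.F k k  ≈⟨ lin-cong (poch-linear k) (Primc.GP-b=c≈F k) ⟨
  poch k · GP-b=c k     ≈⟨ poch-cq-⊛ k (GP-b=c k) ⟨
  poch-cq k ⊛ GP-b=c k  ∎
  where open ≈-Reasoning
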